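{- Let $m,n\ge 1$, let $\pi\in L([n])$ with $\mathrm{type}(\pi)=(t_1,\dots,t_k)$ such that $t_\ell\ge 3$ for some $\ell\ge 3$, and let $\sigma\in L([n]+m)$. Then for every $\pi'\in\Omega_\ell(\pi)$ there exists a bijection $\phi_\ell:S(\pi,\sigma)\to S(\pi',\sigma)$ such that $\mathrm{udr}(\phi_\ell(\tau))=\mathrm{udr}(\tau)$, $\mathrm{pk}(\phi_\ell(\tau))=\mathrm{pk}(\tau)$ and $\mathrm{des}(\phi_\ell(\tau))=\mathrm{des}(\tau)$ for all $\tau\in S(\pi,\sigma)$.
   Context: $[n]=\{1,\dots,n\}$, $[n]+m=\{n+1,\dots,n+m\}$. For a finite $U\subset\mathbb{P}$, $L(U)$ is the set of permutations (words) of $U$. For $\pi=\pi_1\cdots\pi_n$: $\mathrm{des}(\pi)$ is the number of $i\in[n-1]$ with $\pi_i>\pi_{i+1}$; $\mathrm{pk}(\pi)$ is the number of $i$ with $2\le i\le n-1$ and $\pi_{i-1}<\pi_i>\pi_{i+1}$. A birun of a word is a maximal factor of consecutive entries that is strictly increasing or strictly decreasing (consecutive biruns share their common endpoint; e.g. $6534792$ has biruns $653,3479,92$). $\mathrm{udr}(\pi)$ is the number of biruns of the word $0\pi_1\cdots\pi_n$. $\mathrm{type}(\pi)=(t_1,\dots,t_r)$ lists the lengths of the biruns of $\pi$ from left to right. $\chi^+(\pi)=1$ if $\pi_1>\pi_2$, else $0$. For disjoint $U,V$, $\pi\in L(U)$, $\sigma\in L(V)$, $S(\pi,\sigma)$ is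 the set of $\tau\in L(U\cup V)$ containing both $\pi$ and $\sigma$ as subsequences. For $\pi\in L([n])$ with $\mathrm{type}(\pi)=(t_1,\dots,t_k)$ and $t_\ell\ge 3$ for some $\ell\ge 3$, $\Omega_\ell(\pi)$ is the set of $\pi'\in L([n])$ with $\chi^+(\pi')=\chi^+(\pi)$ and $\mathrm{type}(\pi')=(t'_1,\dots,t'_k)$, where $t'_{\ell-2}=t_{\ell-2}+1$, $t'_\ell=t_\ell-1$, and $t'_i=t_i$ for all other $i$. -}

module Defs where

open import Data.Nat.Base using (ℕ; zero; suc; _+_; _∸_; _<ᵇ_; pred)
open import Data.Bool.Base using (Bool; true; false; if_then_else_)
open import Data.List.Base using (List; []; _∷_; _++_; map; upTo; length)
open import Data.Product.Base using (_×_)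
open import Relation.Binary.PropositionalEquality using (_≡_)
open import Data.List.Relation.Binary.Permutation.Propositional using (_↭_)
open import Data.List.Relation.Binary.Sublist.Propositional using (_⊆_)

-- Words are lists of positive naturals.

-- [n] = {1,…,n} as a list, and [n]+m = {n+1,…,n+m}
range : ℕ → List ℕ
range n = map suc (upTo n)

shiftRange : ℕ → ℕ → List ℕ
shiftRange n m = map (λ i → suc (n + i)) (upTo m)

-- π ∈ L(U) : π is a permutation (word) of the elements of U
InL : List ℕ → List ℕ → Set
InL U π = π ↭ U

des : List ℕ → ℕ
des [] = 0
des (x ∷ []) = 0
des (x ∷ y ∷ w) = (if y <ᵇ x then 1 else 0) + des (y ∷ w)

pk : List ℕ → ℕ
pk (x ∷ y ∷ z ∷ w) = (if x <ᵇ y then (if z <ᵇ y then 1 else 0) else 0) + pk (y ∷ z ∷ w)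
pk _ = 0

dirs : List ℕ → List Bool
dirs (x ∷ y ∷ w) = (x <ᵇ y) ∷ dirs (y ∷ w)
dirs _ = []

beq : Bool → Bool → Bool
beq true true = true
beq false false = true
beq _ _ = false

blocksFrom : Bool → ℕ → List Bool → List ℕ
blocksFrom b k [] = k ∷ []
blocksFrom b k (c ∷ cs) = if beq b c then blocksFrom b (suc k) cs else (k ∷ blocksFrom c 1 cs)

blocks : List Bool → List ℕ
blocks [] = []
blocks (b ∷ bs) = blocksFrom b 1 bs

-- type(π): lengths of the biruns of π, left to right.
-- A birun with j adjacent pairs of the same direction has length j+1.
type : List ℕ → List ℕ
type w = map suc (blocks (dirs w))

udr : List ℕ → ℕ
udr w = length (type (0 ∷ w))

χ⁺ : List ℕ → ℕ
χ⁺ (x ∷ y ∷ w) = if y <ᵇ x then 1 else 0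
χ⁺ _ = 0

-- 1-indexed lookup with default 0
nth : List ℕ → ℕ → ℕ
nth [] _ = 0
nth (x ∷ xs) zero = 0
nth (x ∷ xs) (suc zero) = x
nth (x ∷ xs) (suc (suc i)) = nth xs (suc i)

-- apply f at 0-indexed position i
mapAt : ℕ → (ℕ → ℕ) → List ℕ → List ℕ
mapAt _ f [] = []
mapAt zero f (x ∷ xs) = f x ∷ xs
mapAt (suc i) f (x ∷ xs) = x ∷ mapAt i f xs

-- π' ∈ Ω_ℓ(π) (ℓ is 1-indexed): π' ∈ L([n]), χ⁺(π') = χ⁺(π), and
-- type(π') = type(π) with t_{ℓ-2} increased by 1 and t_ℓ decreased by 1.
InΩ : ℕ → ℕ → List ℕ → List ℕ → Set
InΩ n ℓ π π' =
  InL (range n) π' × χ⁺ π' ≡ χ⁺ π ×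
  type π' ≡ mapAt (ℓ ∸ 3) suc (mapAt (ℓ ∸ 1) pred (type π))

InS : List ℕ → List ℕ → List ℕ → Set
InS π σ τ = τ ↭ (π ++ σ) × π ⊆ τ × σ ⊆ τ

{-# OPTIONS --safe #-}
-- A word τ ∈ S(π,σ) is π with gaps g₀,…,gₖ of letters of σ inserted, and its direction word
-- arises from that of π by replacing the direction of the slot i by (ascent, directions of gᵢ,
-- descent) whenever gᵢ is nonempty.  udr, pk and des are functions of the signature of the
-- direction word (first and last letter, numbers of descents, peaks and turns), a monoid
-- homomorphism, so the signature of τ is determined by the directions of π, the signatures of
-- the nonempty gaps and the pattern of empty gaps.  Passing from π to π′ ∈ Ωℓ(π) turns the
-- directions X (¬X)ᵇ⁺¹ X X around birun ℓ-1 into X X (¬X)ᵇ⁺¹ X.  The bijection φ rotates the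
-- pattern of empty gaps in a window of these slots by one step, keeping the sequence of
-- nonempty gaps, hence σ; after factoring out the counts of the gaps, a finite check shows
-- that this leaves the signature unchanged.
module Submission where

open import Defs
open import Data.Bool.Base using (Bool; true; false; not; if_then_else_)
open import Data.Bool.Properties using (¬-not; T-≡)
open import Data.List.Base
  using (List; []; _∷_; _++_; length; map; concat; filter; null; replicate; splitAt; initLast; _∷ʳ′_)
open import Data.List.NonEmpty.Base using (List⁺; toList) renaming (_∷_ to _∷₊_)
open import Data.List.Properties
  using ( ++-assoc; ++-identityʳ; length-map; length-++; length-replicate; map-++; map-injective
        ; filter-all; filter-none; filter-++; filter-accept; filter-reject)
open import Data.List.Relation.Binary.Permutation.Propositional using (_↭_; prep; ↭-refl; ↭-sym; ↭-trans; ↭⇒↭ₛ)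
open import Data.List.Relation.Binary.Permutation.Propositional.Properties
  using (All-resp-↭; filter-↭; ↭-length; shift; ++-comm)
import Data.List.Relation.Binary.Permutation.Setoid.Properties as PermutationSetoid
open import Data.List.Relation.Binary.Pointwise using (Pointwise-≡⇒≡)
open import Data.List.Relation.Binary.Sublist.Heterogeneous.Properties using (toPointwise)
open import Data.List.Relation.Binary.Sublist.Propositional using (_⊆_; [])
open import Data.List.Relation.Binary.Sublist.Propositional.Properties using (filter-⊆; filter⁺)
open import Data.List.Relation.Unary.All as All using (All; []; _∷_)
import Data.List.Relation.Unary.All.Properties as All
open import Data.List.Relation.Unary.Linked using (Linked; []; [-]; _∷_)
open import Data.List.Relation.Unary.Linked.Properties using (AllPairs⇒Linked)
open import Data.List.Relation.Unary.Unique.Propositional using (Unique)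
import Data.List.Relation.Unary.Unique.Propositional.Properties as Unique
open import Data.Maybe.Base using (Maybe; nothing; just)
open import Data.Nat.Base
open import Data.Nat.Properties
  using ( _≤?_; suc-injective; +-identityʳ; +-assoc; +-comm; +-suc; +-cancelˡ-≡; +-monoʳ-≤
        ; ≤-refl; ≤-trans; ≤-antisym; m≤m+n; n≤1+n; m≤n⇒m≤1+n; ≰⇒>; ≮⇒≥; <⇒≱; <⇒≢; <-asym
        ; <⇒<ᵇ; <ᵇ-reflects-<; module ≤-Reasoning)
open import Data.Nat.Tactic.RingSolver using (solve-∀)
open import Data.Product.Base as Product using (_×_; _,_; proj₁; proj₂; uncurry; ∃)
open import Function.Base using (_∘_; id)
open import Function.Bundles using (Equivalence)
open import Level using (Level)
open import Relation.Binary.PropositionalEquality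
import Relation.Binary.PropositionalEquality.Properties as ≡
open import Relation.Nullary using (yes; no)
open import Relation.Nullary.Negation using (contradiction)
open import Relation.Nullary.Reflects using (Reflects; ofʸ; ofⁿ)
open import Relation.Unary using (Pred; Decidable; ∁)
open import Relation.Unary.Properties using (∁?)

<ᵇ-flip : ∀ {x y} → x ≢ y → (y <ᵇ x) ≡ not (x <ᵇ y)
<ᵇ-flip {x} {y} x≢y = ¬-not (flip-≢ (<ᵇ-reflects-< y x) (<ᵇ-reflects-< x y))
  where
  flip-≢ : ∀ {b c} → Reflects (y < x) b → Reflects (x < y) c → b ≢ c
  flip-≢ (ofʸ y<x) (ofʸ x<y) refl = <-asym x<y y<x
  flip-≢ (ofⁿ y≮x) (ofⁿ x≮y) refl = x≢y (≤-antisym (≮⇒≥ y≮x) (≮⇒≥ x≮y))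

descentBit : Bool → ℕ
descentBit true  = 0
descentBit false = 1

descentBit-injective : ∀ {d e} → descentBit d ≡ descentBit e → d ≡ e
descentBit-injective {true}  {true}  _ = refl
descentBit-injective {false} {false} _ = refl

peakBit : Bool → Bool → ℕ
peakBit true false = 1
peakBit _    _     = 0

turnBit : Bool → Bool → ℕ
turnBit true  false = 1
turnBit false true  = 1
turnBit _     _     = 0

-- The signature of a nonempty direction word (true = ascent): first and last letter and the
-- numbers of descents, peaks (factors true false) and turns (unequal neighbours), which is
-- enough to compute these numbers for a concatenation.
data Sig : Set where
  ε  : Sig
  sg : (first last : Bool) (descents peaks turns : ℕ) → Sig

infixr 6 _∙_
_∙_ : Sig → Sig → Sig
ε ∙ t = t
s@(sg _ _ _ _ _) ∙ ε = s
sg f₁ l₁ a₁ b₁ c₁ ∙ sg f₂ l₂ a₂ b₂ c₂ =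
  sg f₁ l₂ (a₁ + a₂) (peakBit l₁ f₂ + (b₁ + b₂)) (turnBit l₁ f₂ + (c₁ + c₂))

∙-identityʳ : ∀ s → s ∙ ε ≡ s
∙-identityʳ ε              = refl
∙-identityʳ (sg _ _ _ _ _) = refl

∙-assoc : ∀ s t u → (s ∙ t) ∙ u ≡ s ∙ (t ∙ u)
∙-assoc ε t u = refl
∙-assoc (sg _ _ _ _ _) ε u = refl
∙-assoc (sg _ _ _ _ _) (sg _ _ _ _ _) ε = refl
∙-assoc (sg f₁ l₁ a₁ b₁ c₁) (sg f₂ l₂ a₂ b₂ c₂) (sg f₃ l₃ a₃ b₃ c₃) =
  cong₂ (λ a bc → sg f₁ l₃ a (proj₁ bc) (proj₂ bc)) (+-assoc a₁ a₂ a₃)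
    (cong₂ _,_ (junctions (peakBit l₁ f₂) (peakBit l₂ f₃) b₁ b₂ b₃)
               (junctions (turnBit l₁ f₂) (turnBit l₂ f₃) c₁ c₂ c₃))
  where
  junctions : ∀ j k x y z → k + ((j + (x + y)) + z) ≡ j + (x + (k + (y + z)))
  junctions = solve-∀

letter : Bool → Sig
letter d = sg d d (descentBit d) 0 0

sig : List Bool → Sig
sig []      = ε
sig (d ∷ D) = letter d ∙ sig D

sig-++ : ∀ D E → sig (D ++ E) ≡ sig D ∙ sig E
sig-++ []      E = refl
sig-++ (d ∷ D) E = trans (cong (letter d ∙_) (sig-++ D E)) (sym (∙-assoc (letter d) (sig D) (sig E)))

descents peaks : Sig → ℕ
descents ε              = 0
descents (sg _ _ a _ _) = a
peaks ε              = 0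
peaks (sg _ _ _ b _) = b

turnsAfter : Bool → Sig → ℕ
turnsAfter d ε              = 0
turnsAfter d (sg f _ _ _ c) = turnBit d f + c

descents-letter∙ : ∀ d s → descents (letter d ∙ s) ≡ descentBit d + descents s
descents-letter∙ d ε              = sym (+-identityʳ _)
descents-letter∙ d (sg _ _ _ _ _) = refl

peaks-letter∙ : ∀ d e t → peaks (letter d ∙ letter e ∙ t) ≡ peakBit d e + peaks (letter e ∙ t)
peaks-letter∙ d e ε              = refl
peaks-letter∙ d e (sg _ _ _ _ _) = refl

χ⁺≡descentBit : ∀ {x y} w → x ≢ y → χ⁺ (x ∷ y ∷ w) ≡ descentBit (x <ᵇ y)
χ⁺≡descentBit {x} {y} w x≢y = trans (cong (λ b → if b then 1 else 0) (<ᵇ-flip x≢y)) (ifNot (x <ᵇ y))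
  where
  ifNot : ∀ b → (if not b then 1 else 0) ≡ descentBit b
  ifNot true  = refl
  ifNot false = refl

des≡descents : ∀ {w} → Linked _≢_ w → des w ≡ descents (sig (dirs w))
des≡descents []  = refl
des≡descents [-] = refl
des≡descents {x ∷ y ∷ w} (x≢y ∷ l) = begin
  χ⁺ (x ∷ y ∷ w) + des (y ∷ w)                        ≡⟨ cong₂ _+_ (χ⁺≡descentBit w x≢y) (des≡descents l) ⟩
  descentBit (x <ᵇ y) + descents (sig (dirs (y ∷ w))) ≡⟨ descents-letter∙ (x <ᵇ y) (sig (dirs (y ∷ w))) ⟨
  descents (sig (dirs (x ∷ y ∷ w)))                   ∎
  where open ≡-Reasoning

pk≡peaks : ∀ {w} → Linked _≢_ w → pk w ≡ peaks (sig (dirs w))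
pk≡peaks []  = refl
pk≡peaks [-] = refl
pk≡peaks (_ ∷ [-]) = refl
pk≡peaks {x ∷ y ∷ z ∷ w} (_ ∷ l@(y≢z ∷ _)) = begin
  (if x <ᵇ y then (if z <ᵇ y then 1 else 0) else 0) + pk (y ∷ z ∷ w)
    ≡⟨ cong₂ _+_ (cong (λ b → if x <ᵇ y then (if b then 1 else 0) else 0) (<ᵇ-flip y≢z)) (pk≡peaks l) ⟩
  (if x <ᵇ y then (if not (y <ᵇ z) then 1 else 0) else 0) + peaks (sig (dirs (y ∷ z ∷ w)))
    ≡⟨ cong (_+ _) (ifPeak (x <ᵇ y) (y <ᵇ z)) ⟩
  peakBit (x <ᵇ y) (y <ᵇ z) + peaks (sig (dirs (y ∷ z ∷ w)))
    ≡⟨ peaks-letter∙ (x <ᵇ y) (y <ᵇ z) (sig (dirs (z ∷ w))) ⟨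
  peaks (sig (dirs (x ∷ y ∷ z ∷ w))) ∎
  where
  open ≡-Reasoning
  ifPeak : ∀ a b → (if a then (if not b then 1 else 0) else 0) ≡ peakBit a b
  ifPeak true  true  = refl
  ifPeak true  false = refl
  ifPeak false _     = refl

turnsAfter-letter∙ : ∀ d e s → turnsAfter d (letter e ∙ s) ≡ turnBit d e + turnsAfter e s
turnsAfter-letter∙ d e ε              = refl
turnsAfter-letter∙ d e (sg _ _ _ _ _) = refl

length-blocksFrom : ∀ d k D → length (blocksFrom d k D) ≡ suc (turnsAfter d (sig D))
length-blocksFrom d k [] = refl
length-blocksFrom d k (e ∷ D) rewrite turnsAfter-letter∙ d e (sig D) with d | e
... | true  | true  = length-blocksFrom true (suc k) D
... | true  | false = cong suc (length-blocksFrom false 1 D)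
... | false | true  = cong suc (length-blocksFrom true 1 D)
... | false | false = length-blocksFrom false (suc k) D

-- The prepended 0 makes the first direction of 0 ∷ w an ascent.
udr≡turnsAfter : ∀ {w} → All (0 <_) w → w ≢ [] → udr w ≡ suc (turnsAfter true (sig (dirs w)))
udr≡turnsAfter {[]}        _        w≢[] = contradiction refl w≢[]
udr≡turnsAfter {zero ∷ w}  (() ∷ _) _
udr≡turnsAfter {suc x ∷ w} _        _    =
  trans (length-map suc (blocksFrom true 1 (dirs (suc x ∷ w)))) (length-blocksFrom true 1 (dirs (suc x ∷ w)))

sig-determines-stats : ∀ {v w} → Linked _≢_ v → Linked _≢_ w → All (0 <_) v → All (0 <_) w →
                       v ≢ [] → w ≢ [] → sig (dirs v) ≡ sig (dirs w) →
                       udr v ≡ udr w × pk v ≡ pk w × des v ≡ des w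
sig-determines-stats lv lw pv pw v≢[] w≢[] eq =
  trans (udr≡turnsAfter pv v≢[]) (trans (cong (suc ∘ turnsAfter true) eq) (sym (udr≡turnsAfter pw w≢[]))) ,
  trans (pk≡peaks lv) (trans (cong peaks eq) (sym (pk≡peaks lw))) ,
  trans (des≡descents lv) (trans (cong descents eq) (sym (des≡descents lw)))

⊆∧length≡⇒≡ : ∀ {A : Set} {xs ys : List A} → xs ⊆ ys → length xs ≡ length ys → xs ≡ ys
⊆∧length≡⇒≡ xs⊆ys eq = Pointwise-≡⇒≡ (toPointwise eq xs⊆ys)

module _ {A : Set} {p : Level} {P : Pred A p} (P? : Decidable P) where

  filter-++-split : ∀ {xs ys} → All P xs → All (∁ P) ys → filter P? (xs ++ ys) ≡ xs
  filter-++-split {xs} {ys} pxs ¬pys = begin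
    filter P? (xs ++ ys)           ≡⟨ filter-++ P? xs ys ⟩
    filter P? xs ++ filter P? ys   ≡⟨ cong₂ _++_ (filter-all P? pxs) (filter-none P? ¬pys) ⟩
    xs ++ []                       ≡⟨ ++-identityʳ xs ⟩
    xs                             ∎
    where open ≡-Reasoning

  filter-shuffle : ∀ {xs ys zs} → All P xs → All (∁ P) ys → zs ↭ xs ++ ys → xs ⊆ zs → filter P? zs ≡ xs
  filter-shuffle {xs} {ys} {zs} pxs ¬pys zs↭ xs⊆zs = sym (⊆∧length≡⇒≡ xs⊆filter (sym length≡))
    where
    xs⊆filter : xs ⊆ filter P? zs
    xs⊆filter = subst (_⊆ filter P? zs) (filter-all P? pxs) (filter⁺ P? P? (λ { refl p → p }) xs⊆zs)
    length≡ : length (filter P? zs) ≡ length xs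
    length≡ = trans (↭-length (filter-↭ P? zs↭)) (cong length (filter-++-split pxs ¬pys))

  ↭-filter++filter∁ : ∀ zs → zs ↭ filter P? zs ++ filter (∁? P?) zs
  ↭-filter++filter∁ []       = ↭-refl
  ↭-filter++filter∁ (z ∷ zs) with P? z
  ... | yes _ = prep z (↭-filter++filter∁ zs)
  ... | no  _ = ↭-trans (prep z (↭-filter++filter∁ zs)) (↭-sym (shift z (filter P? zs) _))

smalls bigs : ℕ → List ℕ → List ℕ
smalls n = filter (_≤? n)
bigs   n = filter (∁? (_≤? n))

module _ {n : ℕ} {π σ : List ℕ} (π≤n : All (_≤ n) π) (σ≰n : All (_≰ n) σ) where

  InS⇒smalls∧bigs : ∀ {τ} → InS π σ τ → smalls n τ ≡ π × bigs n τ ≡ σ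
  InS⇒smalls∧bigs (τ↭ , π⊆τ , σ⊆τ) =
    filter-shuffle (_≤? n) π≤n σ≰n τ↭ π⊆τ ,
    filter-shuffle (∁? (_≤? n)) σ≰n (All.map (λ x≤n x≰n → x≰n x≤n) π≤n) (↭-trans τ↭ (++-comm π σ)) σ⊆τ

smalls∧bigs⇒InS : ∀ {n π σ τ} → smalls n τ ≡ π → bigs n τ ≡ σ → InS π σ τ
smalls∧bigs⇒InS {n} {τ = τ} refl refl = ↭-filter++filter∁ (_≤? n) τ , filter-⊆ (_≤? n) τ , filter-⊆ (∁? (_≤? n)) τ

-- splitGaps n w = (g₀ , g₁ ∷ … ∷ gₖ), where g₀ x₁ g₁ x₂ ⋯ xₖ gₖ = w, the xᵢ are the small
-- letters (≤ n) of w and the gaps gᵢ consist of big letters.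
splitGaps : ℕ → List ℕ → List ℕ × List (List ℕ)
splitGaps n []      = [] , []
splitGaps n (x ∷ w) with x ≤? n
... | yes _ = [] , uncurry _∷_ (splitGaps n w)
... | no  _ = Product.map₁ (x ∷_) (splitGaps n w)

gaps : ℕ → List ℕ → List (List ℕ)
gaps n w = uncurry _∷_ (splitGaps n w)

fillGaps : List ℕ → List (List ℕ) → List ℕ
fillGaps []      (g ∷ _)  = g
fillGaps (x ∷ u) (g ∷ gs) = g ++ x ∷ fillGaps u gs
fillGaps u       []       = u

GapsFor : ℕ → List ℕ → List (List ℕ) → Set
GapsFor n u gs = All (All (_≰ n)) gs × length gs ≡ suc (length u)

module _ {n : ℕ} where

  fillGaps-cons : ∀ x u g gs → fillGaps u ((x ∷ g) ∷ gs) ≡ x ∷ fillGaps u (g ∷ gs)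
  fillGaps-cons x []      g gs = refl
  fillGaps-cons x (_ ∷ _) g gs = refl

  fillGaps-gaps : ∀ w → fillGaps (smalls n w) (gaps n w) ≡ w
  fillGaps-gaps []      = refl
  fillGaps-gaps (x ∷ w) with x ≤? n
  ... | yes x≤n = trans (cong (λ u → fillGaps u ([] ∷ gaps n w)) (filter-accept (_≤? n) x≤n))
                        (cong (x ∷_) (fillGaps-gaps w))
  ... | no  x≰n = trans (cong (λ u → fillGaps u ((x ∷ _) ∷ _)) (filter-reject (_≤? n) x≰n))
                        (trans (fillGaps-cons x (smalls n w) _ _) (cong (x ∷_) (fillGaps-gaps w)))

  concat-gaps : ∀ w → concat (gaps n w) ≡ bigs n w
  concat-gaps []      = refl
  concat-gaps (x ∷ w) with x ≤? n
  ... | yes x≤n = trans (concat-gaps w) (sym (filter-reject (∁? (_≤? n)) (λ x≰n → x≰n x≤n)))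
  ... | no  x≰n = trans (cong (x ∷_) (concat-gaps w)) (sym (filter-accept (∁? (_≤? n)) x≰n))

  gaps-GapsFor : ∀ w → GapsFor n (smalls n w) (gaps n w)
  gaps-GapsFor []      = ([] ∷ []) , refl
  gaps-GapsFor (x ∷ w) with x ≤? n | gaps-GapsFor w
  ... | yes x≤n | big , len         = ([] ∷ big) , trans (cong suc len) (cong (λ u → suc (length u)) (sym (filter-accept (_≤? n) x≤n)))
  ... | no  x≰n | (g≰n ∷ big) , len = ((x≰n ∷ g≰n) ∷ big) , trans len (cong (λ u → suc (length u)) (sym (filter-reject (_≤? n) x≰n)))

  splitGaps-small∷ : ∀ {x} w → x ≤ n → splitGaps n (x ∷ w) ≡ ([] , gaps n w)
  splitGaps-small∷ {x} w x≤n with x ≤? n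
  ... | yes _   = refl
  ... | no  x≰n = contradiction x≤n x≰n

  splitGaps-big++ : ∀ {g} ys → All (_≰ n) g → splitGaps n (g ++ ys) ≡ Product.map₁ (g ++_) (splitGaps n ys)
  splitGaps-big++ ys []                 = refl
  splitGaps-big++ {x ∷ g} ys (x≰n ∷ g≰n) with x ≤? n
  ... | yes x≤n = contradiction x≤n x≰n
  ... | no  _   = cong (Product.map₁ (x ∷_)) (splitGaps-big++ ys g≰n)

  splitGaps-big : ∀ {g} → All (_≰ n) g → splitGaps n g ≡ (g , [])
  splitGaps-big [] = refl
  splitGaps-big {x ∷ g} (x≰n ∷ g≰n) with x ≤? n
  ... | yes x≤n = contradiction x≤n x≰n
  ... | no  _   = cong (Product.map₁ (x ∷_)) (splitGaps-big g≰n)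

  gaps-fillGaps : ∀ {u gs} → All (_≤ n) u → GapsFor n u gs → gaps n (fillGaps u gs) ≡ gs
  gaps-fillGaps {[]} {g ∷ []} [] (g≰n ∷ [] , _) = cong (uncurry _∷_) (splitGaps-big g≰n)
  gaps-fillGaps {x ∷ u} {g ∷ g′ ∷ gs} (x≤n ∷ u≤n) (g≰n ∷ big , len) = cong (uncurry _∷_) (begin
    splitGaps n (g ++ x ∷ fillGaps u (g′ ∷ gs))                    ≡⟨ splitGaps-big++ _ g≰n ⟩
    Product.map₁ (g ++_) (splitGaps n (x ∷ fillGaps u (g′ ∷ gs))) ≡⟨ cong (Product.map₁ (g ++_)) (splitGaps-small∷ _ x≤n) ⟩
    (g ++ [] , gaps n (fillGaps u (g′ ∷ gs)))                      ≡⟨ cong₂ _,_ (++-identityʳ g)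
                                                                                  (gaps-fillGaps u≤n (big , suc-injective len)) ⟩
    (g , g′ ∷ gs)                                                   ∎)
    where open ≡-Reasoning

  smalls-fillGaps : ∀ {u gs} → All (_≤ n) u → GapsFor n u gs → smalls n (fillGaps u gs) ≡ u
  smalls-fillGaps {[]} {g ∷ []} [] (g≰n ∷ [] , _) = filter-none (_≤? n) g≰n
  smalls-fillGaps {x ∷ u} {g ∷ g′ ∷ gs} (x≤n ∷ u≤n) (g≰n ∷ big , len) = begin
    smalls n (g ++ x ∷ fillGaps u (g′ ∷ gs))                    ≡⟨ filter-++ (_≤? n) g _ ⟩
    smalls n g ++ smalls n (x ∷ fillGaps u (g′ ∷ gs))           ≡⟨ cong₂ _++_ (filter-none (_≤? n) g≰n) (filter-accept (_≤? n) x≤n) ⟩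
    x ∷ smalls n (fillGaps u (g′ ∷ gs))                         ≡⟨ cong (x ∷_) (smalls-fillGaps u≤n (big , suc-injective len)) ⟩
    x ∷ u                                                       ∎
    where open ≡-Reasoning

  bigs-fillGaps : ∀ {u gs} → All (_≤ n) u → GapsFor n u gs → bigs n (fillGaps u gs) ≡ concat gs
  bigs-fillGaps {[]} {g ∷ []} [] (g≰n ∷ [] , _) = trans (filter-all (∁? (_≤? n)) g≰n) (sym (++-identityʳ g))
  bigs-fillGaps {x ∷ u} {g ∷ g′ ∷ gs} (x≤n ∷ u≤n) (g≰n ∷ big , len) = begin
    bigs n (g ++ x ∷ fillGaps u (g′ ∷ gs))                      ≡⟨ filter-++ (∁? (_≤? n)) g _ ⟩
    bigs n g ++ bigs n (x ∷ fillGaps u (g′ ∷ gs))               ≡⟨ cong₂ _++_ (filter-all (∁? (_≤? n)) g≰n)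
                                                                            (filter-reject (∁? (_≤? n)) (λ x≰n → x≰n x≤n)) ⟩
    g ++ bigs n (fillGaps u (g′ ∷ gs))                          ≡⟨ cong (g ++_) (bigs-fillGaps u≤n (big , suc-injective len)) ⟩
    g ++ concat (g′ ∷ gs)                                       ∎
    where open ≡-Reasoning

<⇒<ᵇ≡true : ∀ {x y} → x < y → (x <ᵇ y) ≡ true
<⇒<ᵇ≡true x<y = Equivalence.to T-≡ (<⇒<ᵇ x<y)

>⇒<ᵇ≡false : ∀ {x y} → y < x → (x <ᵇ y) ≡ false
>⇒<ᵇ≡false y<x = trans (<ᵇ-flip (<⇒≢ y<x)) (cong not (<⇒<ᵇ≡true y<x))

small<big : ∀ {n x y} → x ≤ n → y ≰ n → x < y
small<big x≤n y≰n = ≤-trans (s≤s x≤n) (≰⇒> y≰n)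

leadDirs : List ℕ → List Bool
leadDirs []      = []
leadDirs (y ∷ g) = dirs (y ∷ g) ++ false ∷ []

slotDirs : Bool → List ℕ → List Bool
slotDirs d []      = d ∷ []
slotDirs d (y ∷ g) = true ∷ dirs (y ∷ g) ++ false ∷ []

trailDirs : List ℕ → List Bool
trailDirs []      = []
trailDirs (y ∷ g) = true ∷ dirs (y ∷ g)

-- Directions of the factors filling the slots of D with the gaps I; gapDirs also places the
-- last gap of I after the end of D.
innerDirs gapDirs : List Bool → List (List ℕ) → List Bool
innerDirs (d ∷ D) (g ∷ I) = slotDirs d g ++ innerDirs D I
innerDirs _       _       = []
gapDirs (d ∷ D) (g ∷ I) = slotDirs d g ++ gapDirs D I
gapDirs []      (g ∷ _) = trailDirs g
gapDirs _       []      = []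

module _ {n : ℕ} where

  dirs-big++small : ∀ {y x} g R → All (_≰ n) (y ∷ g) → x ≤ n →
                    dirs (y ∷ g ++ x ∷ R) ≡ dirs (y ∷ g) ++ false ∷ dirs (x ∷ R)
  dirs-big++small {x = x} [] R (y≰n ∷ []) x≤n = cong (_∷ dirs (x ∷ R)) (>⇒<ᵇ≡false (small<big x≤n y≰n))
  dirs-big++small {y} (z ∷ g) R (_ ∷ zg≰n) x≤n = cong ((y <ᵇ z) ∷_) (dirs-big++small g R zg≰n x≤n)

  dirs-small∷fillGaps : ∀ {x u I} → x ≤ n → All (_≤ n) u → GapsFor n u I →
                        dirs (x ∷ fillGaps u I) ≡ gapDirs (dirs (x ∷ u)) I
  dirs-small∷fillGaps {u = []} {[] ∷ []} _ _ _ = refl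
  dirs-small∷fillGaps {u = []} {(y ∷ g) ∷ []} x≤n _ ((y≰n ∷ _) ∷ [] , _) =
    cong (_∷ dirs (y ∷ g)) (<⇒<ᵇ≡true (small<big x≤n y≰n))
  dirs-small∷fillGaps {x} {x′ ∷ u} {[] ∷ I} _ (x′≤n ∷ u≤n) (_ ∷ big , len) =
    cong ((x <ᵇ x′) ∷_) (dirs-small∷fillGaps x′≤n u≤n (big , suc-injective len))
  dirs-small∷fillGaps {x} {x′ ∷ u} {(y ∷ g) ∷ I} x≤n (x′≤n ∷ u≤n) (yg≰n@(y≰n ∷ _) ∷ big , len) =
    cong₂ _∷_ (<⇒<ᵇ≡true (small<big x≤n y≰n)) (begin
      dirs (y ∷ g ++ x′ ∷ fillGaps u I)                        ≡⟨ dirs-big++small g _ yg≰n x′≤n ⟩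
      dirs (y ∷ g) ++ false ∷ dirs (x′ ∷ fillGaps u I)         ≡⟨ cong (λ D → dirs (y ∷ g) ++ false ∷ D)
                                                                     (dirs-small∷fillGaps x′≤n u≤n (big , suc-injective len)) ⟩
      dirs (y ∷ g) ++ false ∷ gapDirs (dirs (x′ ∷ u)) I        ≡⟨ ++-assoc (dirs (y ∷ g)) (false ∷ []) _ ⟨
      (dirs (y ∷ g) ++ false ∷ []) ++ gapDirs (dirs (x′ ∷ u)) I ∎)
    where open ≡-Reasoning

  dirs-fillGaps : ∀ {x u g I} → All (_≤ n) (x ∷ u) → GapsFor n (x ∷ u) (g ∷ I) →
                  dirs (fillGaps (x ∷ u) (g ∷ I)) ≡ leadDirs g ++ gapDirs (dirs (x ∷ u)) I
  dirs-fillGaps {g = []} (x≤n ∷ u≤n) (_ ∷ big , len) = dirs-small∷fillGaps x≤n u≤n (big , suc-injective len)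
  dirs-fillGaps {x} {u} {y ∷ g} {I} (x≤n ∷ u≤n) (yg≰n ∷ big , len) = begin
    dirs (y ∷ g ++ x ∷ fillGaps u I)                     ≡⟨ dirs-big++small g _ yg≰n x≤n ⟩
    dirs (y ∷ g) ++ false ∷ dirs (x ∷ fillGaps u I)      ≡⟨ cong (λ D → dirs (y ∷ g) ++ false ∷ D)
                                                              (dirs-small∷fillGaps x≤n u≤n (big , suc-injective len)) ⟩
    dirs (y ∷ g) ++ false ∷ gapDirs (dirs (x ∷ u)) I     ≡⟨ ++-assoc (dirs (y ∷ g)) (false ∷ []) _ ⟨
    leadDirs (y ∷ g) ++ gapDirs (dirs (x ∷ u)) I         ∎
    where open ≡-Reasoning

gapDirs-++ : ∀ D E I J → length I ≡ length D → gapDirs (D ++ E) (I ++ J) ≡ innerDirs D I ++ gapDirs E J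
gapDirs-++ []      E []      J _   = refl
gapDirs-++ (d ∷ D) E (g ∷ I) J len =
  trans (cong (slotDirs d g ++_) (gapDirs-++ D E I J (suc-injective len))) (sym (++-assoc (slotDirs d g) _ _))

-- rotateIn A z is A ++ [z] with its pattern of empty entries rotated one step to the right and
-- its nonempty entries kept in order; pushGap and pullGap shift the nonempty entries along.
pushGap : List⁺ ℕ → List (List ℕ) → List⁺ ℕ × List (List ℕ)
pushGap v []            = v , []
pushGap v ([] ∷ I)      = Product.map₂ ([] ∷_) (pushGap v I)
pushGap v ((y ∷ g) ∷ I) = (y ∷₊ g) , toList (proj₁ (pushGap v I)) ∷ proj₂ (pushGap v I)

pullGap : List⁺ ℕ → List (List ℕ) → List (List ℕ) × List⁺ ℕ
pullGap v []            = [] , v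
pullGap v ([] ∷ I)      = Product.map₁ ([] ∷_) (pullGap v I)
pullGap v ((y ∷ g) ∷ I) = Product.map₁ (toList v ∷_) (pullGap (y ∷₊ g) I)

rotateIn : List (List ℕ) → List ℕ → List (List ℕ)
rotateIn A []      = [] ∷ A
rotateIn A (y ∷ g) = toList (proj₁ (pushGap (y ∷₊ g) A)) ∷ proj₂ (pushGap (y ∷₊ g) A)

rotateOut : List (List ℕ) → List (List ℕ) × List ℕ
rotateOut []            = [] , []
rotateOut ([] ∷ B)      = B , []
rotateOut ((y ∷ g) ∷ B) = Product.map₂ toList (pullGap (y ∷₊ g) B)

pullGap-pushGap : ∀ v I → uncurry pullGap (pushGap v I) ≡ (I , v)
pullGap-pushGap v []            = refl
pullGap-pushGap v ([] ∷ I)      = cong (Product.map₁ ([] ∷_)) (pullGap-pushGap v I)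
pullGap-pushGap v ((y ∷ g) ∷ I) = cong (Product.map₁ ((y ∷ g) ∷_)) (pullGap-pushGap v I)

pushGap-pullGap : ∀ v I → uncurry (λ I′ v′ → pushGap v′ I′) (pullGap v I) ≡ (v , I)
pushGap-pullGap v []            = refl
pushGap-pullGap v ([] ∷ I)      = cong (Product.map₂ ([] ∷_)) (pushGap-pullGap v I)
pushGap-pullGap v ((y ∷ g) ∷ I) = cong (λ p → v , toList (proj₁ p) ∷ proj₂ p) (pushGap-pullGap (y ∷₊ g) I)

rotateOut-rotateIn : ∀ A z → rotateOut (rotateIn A z) ≡ (A , z)
rotateOut-rotateIn A []      = refl
rotateOut-rotateIn A (y ∷ g) = cong (Product.map₂ toList) (pullGap-pushGap (y ∷₊ g) A)

rotateIn-rotateOut : ∀ {b} B → uncurry rotateIn (rotateOut (b ∷ B)) ≡ b ∷ B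
rotateIn-rotateOut {[]}    B = refl
rotateIn-rotateOut {y ∷ g} B = cong (λ p → toList (proj₁ p) ∷ proj₂ p) (pushGap-pullGap (y ∷₊ g) B)

null-pushGap : ∀ v I → map null (proj₂ (pushGap v I)) ≡ map null I
null-pushGap v []            = refl
null-pushGap v ([] ∷ I)      = cong (_ ∷_) (null-pushGap v I)
null-pushGap v ((_ ∷ _) ∷ I) = cong (_ ∷_) (null-pushGap v I)

null-rotateIn : ∀ A z → map null (rotateIn A z) ≡ null z ∷ map null A
null-rotateIn A []      = refl
null-rotateIn A (y ∷ g) = cong (_ ∷_) (null-pushGap (y ∷₊ g) A)

length-rotateIn : ∀ A z → length (rotateIn A z) ≡ suc (length A)
length-rotateIn A z = begin
  length (rotateIn A z)           ≡⟨ length-map null (rotateIn A z) ⟨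
  length (map null (rotateIn A z)) ≡⟨ cong length (null-rotateIn A z) ⟩
  suc (length (map null A))       ≡⟨ cong suc (length-map null A) ⟩
  suc (length A)                  ∎
  where open ≡-Reasoning

nonEmptyGaps : List (List ℕ) → List (List ℕ)
nonEmptyGaps []            = []
nonEmptyGaps ([] ∷ I)      = nonEmptyGaps I
nonEmptyGaps ((y ∷ g) ∷ I) = (y ∷ g) ∷ nonEmptyGaps I

nonEmptyGaps-++ : ∀ I J → nonEmptyGaps (I ++ J) ≡ nonEmptyGaps I ++ nonEmptyGaps J
nonEmptyGaps-++ []            J = refl
nonEmptyGaps-++ ([] ∷ I)      J = nonEmptyGaps-++ I J
nonEmptyGaps-++ ((y ∷ g) ∷ I) J = cong ((y ∷ g) ∷_) (nonEmptyGaps-++ I J)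

concat-nonEmptyGaps : ∀ I → concat (nonEmptyGaps I) ≡ concat I
concat-nonEmptyGaps []            = refl
concat-nonEmptyGaps ([] ∷ I)      = concat-nonEmptyGaps I
concat-nonEmptyGaps ((y ∷ g) ∷ I) = cong ((y ∷ g) ++_) (concat-nonEmptyGaps I)

nonEmptyGaps-pushGap : ∀ v I → toList (proj₁ (pushGap v I)) ∷ nonEmptyGaps (proj₂ (pushGap v I)) ≡ nonEmptyGaps I ++ toList v ∷ []
nonEmptyGaps-pushGap v []            = refl
nonEmptyGaps-pushGap v ([] ∷ I)      = nonEmptyGaps-pushGap v I
nonEmptyGaps-pushGap v ((y ∷ g) ∷ I) = cong ((y ∷ g) ∷_) (nonEmptyGaps-pushGap v I)

nonEmptyGaps-rotateIn : ∀ A z → nonEmptyGaps (rotateIn A z) ≡ nonEmptyGaps (A ++ z ∷ [])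
nonEmptyGaps-rotateIn A []      = trans (sym (++-identityʳ (nonEmptyGaps A))) (sym (nonEmptyGaps-++ A ([] ∷ [])))
nonEmptyGaps-rotateIn A (y ∷ g) = trans (nonEmptyGaps-pushGap (y ∷₊ g) A) (sym (nonEmptyGaps-++ A ((y ∷ g) ∷ [])))

module _ {X : Set} where

  splitAt-++ : ∀ {k} (A B : List X) → length A ≡ k → splitAt k (A ++ B) ≡ (A , B)
  splitAt-++ []      B refl = refl
  splitAt-++ (x ∷ A) B refl = cong (Product.map₁ (x ∷_)) (splitAt-++ A B refl)

  cutView : ∀ a (L : List X) → suc a ≤ length L → ∃ λ A → ∃ λ z → ∃ λ Q → L ≡ A ++ z ∷ Q × length A ≡ a
  cutView zero    (z ∷ Q) _        = [] , z , Q , refl , refl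
  cutView (suc a) (x ∷ L) (s≤s le) with cutView a L le
  ... | A , z , Q , L≡ , |A| = x ∷ A , z , Q , cong (x ∷_) L≡ , cong suc |A|

  windowView : ∀ j a (L : List X) → j + suc a ≤ length L →
               ∃ λ P → ∃ λ A → ∃ λ z → ∃ λ Q → L ≡ P ++ A ++ z ∷ Q × length P ≡ j × length A ≡ a
  windowView zero    a L       fits     with cutView a L fits
  ... | A , z , Q , L≡ , |A| = [] , A , z , Q , L≡ , refl , |A|
  windowView (suc j) a (x ∷ L) (s≤s le) with windowView j a L le
  ... | P , A , z , Q , L≡ , |P| , |A| = x ∷ P , A , z , Q , cong (x ∷_) L≡ , cong suc |P| , |A|

rotateOnto : List (List ℕ) → List (List ℕ) → List (List ℕ)
rotateOnto A (z ∷ Q) = rotateIn A z ++ Q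
rotateOnto A []      = A

rotateOutOnto : List (List ℕ) → List (List ℕ) → List (List ℕ)
rotateOutOnto B Q = proj₁ (rotateOut B) ++ proj₂ (rotateOut B) ∷ Q

-- Rotate, resp. rotate back, the window of a + 1 entries starting at position j.
rotateWindow unrotateWindow : ℕ → ℕ → List (List ℕ) → List (List ℕ)
rotateWindow j a L =
  let P , R = splitAt j L
      A , B = splitAt a R
  in P ++ rotateOnto A B
unrotateWindow j a L =
  let P , R = splitAt j L
      B , Q = splitAt (suc a) R
  in P ++ rotateOutOnto B Q

module _ {j a : ℕ} (P A : List (List ℕ)) (z : List ℕ) (Q : List (List ℕ)) (|P| : length P ≡ j) (|A| : length A ≡ a) where

  rotateWindow-view : rotateWindow j a (P ++ A ++ z ∷ Q) ≡ P ++ rotateIn A z ++ Q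
  rotateWindow-view rewrite splitAt-++ P (A ++ z ∷ Q) |P| | splitAt-++ A (z ∷ Q) |A| = refl

  unrotateWindow-view : unrotateWindow j a (P ++ rotateIn A z ++ Q) ≡ P ++ A ++ z ∷ Q
  unrotateWindow-view
    rewrite splitAt-++ P (rotateIn A z ++ Q) |P|
          | splitAt-++ (rotateIn A z) Q (trans (length-rotateIn A z) (cong suc |A|))
          | rotateOut-rotateIn A z = refl

rotateIn-rotateOut-snoc : ∀ A z → uncurry rotateIn (rotateOut (A ++ z ∷ [])) ≡ A ++ z ∷ []
rotateIn-rotateOut-snoc []      z = rotateIn-rotateOut []
rotateIn-rotateOut-snoc (x ∷ A) z = rotateIn-rotateOut (A ++ z ∷ [])

rotatedView : ∀ j a (L : List (List ℕ)) → j + suc a ≤ length L →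
              ∃ λ P → ∃ λ A → ∃ λ z → ∃ λ Q → L ≡ P ++ rotateIn A z ++ Q × length P ≡ j × length A ≡ a
rotatedView j a L fits with windowView j a L fits
... | P , A′ , z′ , Q , L≡ , |P| , |A′| = P , A , z , Q , trans L≡ L≡rotated , |P| , |A|
  where
  A = proj₁ (rotateOut (A′ ++ z′ ∷ []))
  z = proj₂ (rotateOut (A′ ++ z′ ∷ []))
  B≡ : rotateIn A z ≡ A′ ++ z′ ∷ []
  B≡ = rotateIn-rotateOut-snoc A′ z′
  L≡rotated : P ++ A′ ++ z′ ∷ Q ≡ P ++ rotateIn A z ++ Q
  L≡rotated = cong (P ++_) (trans (sym (++-assoc A′ (z′ ∷ []) Q)) (cong (_++ Q) (sym B≡)))
  |A| : length A ≡ a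
  |A| = suc-injective (begin
    suc (length A)              ≡⟨ length-rotateIn A z ⟨
    length (rotateIn A z)       ≡⟨ cong length B≡ ⟩
    length (A′ ++ z′ ∷ [])      ≡⟨ length-++ A′ ⟩
    length A′ + 1               ≡⟨ +-comm (length A′) 1 ⟩
    suc (length A′)             ≡⟨ cong suc |A′| ⟩
    suc a                       ∎)
    where open ≡-Reasoning

module _ (P A : List (List ℕ)) (z : List ℕ) (Q : List (List ℕ)) where

  length-rotated : length (P ++ rotateIn A z ++ Q) ≡ length (P ++ A ++ z ∷ Q)
  length-rotated rewrite length-++ P {rotateIn A z ++ Q} | length-++ P {A ++ z ∷ Q}
                       | length-++ (rotateIn A z) {Q} | length-rotateIn A z
                       | length-++ A {z ∷ Q} | +-suc (length A) (length Q) = refl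

  nonEmptyGaps-rotated : nonEmptyGaps (P ++ rotateIn A z ++ Q) ≡ nonEmptyGaps (P ++ A ++ z ∷ Q)
  nonEmptyGaps-rotated = begin
    nonEmptyGaps (P ++ rotateIn A z ++ Q)                               ≡⟨ nonEmptyGaps-++ P _ ⟩
    nonEmptyGaps P ++ nonEmptyGaps (rotateIn A z ++ Q)                  ≡⟨ cong (nonEmptyGaps P ++_) (nonEmptyGaps-++ (rotateIn A z) Q) ⟩
    nonEmptyGaps P ++ nonEmptyGaps (rotateIn A z) ++ nonEmptyGaps Q     ≡⟨ cong (λ I → nonEmptyGaps P ++ I ++ nonEmptyGaps Q) (nonEmptyGaps-rotateIn A z) ⟩
    nonEmptyGaps P ++ nonEmptyGaps (A ++ z ∷ []) ++ nonEmptyGaps Q      ≡⟨ cong (nonEmptyGaps P ++_) (nonEmptyGaps-++ (A ++ z ∷ []) Q) ⟨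
    nonEmptyGaps P ++ nonEmptyGaps ((A ++ z ∷ []) ++ Q)                 ≡⟨ cong (λ I → nonEmptyGaps P ++ nonEmptyGaps I) (++-assoc A (z ∷ []) Q) ⟩
    nonEmptyGaps P ++ nonEmptyGaps (A ++ z ∷ Q)                         ≡⟨ nonEmptyGaps-++ P _ ⟨
    nonEmptyGaps (P ++ A ++ z ∷ Q)                                      ∎
    where open ≡-Reasoning

  concat-rotated : concat (P ++ rotateIn A z ++ Q) ≡ concat (P ++ A ++ z ∷ Q)
  concat-rotated = begin
    concat (P ++ rotateIn A z ++ Q)                 ≡⟨ concat-nonEmptyGaps (P ++ rotateIn A z ++ Q) ⟨
    concat (nonEmptyGaps (P ++ rotateIn A z ++ Q))  ≡⟨ cong concat nonEmptyGaps-rotated ⟩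
    concat (nonEmptyGaps (P ++ A ++ z ∷ Q))         ≡⟨ concat-nonEmptyGaps (P ++ A ++ z ∷ Q) ⟩
    concat (P ++ A ++ z ∷ Q)                        ∎
    where open ≡-Reasoning

data Counts : Set where
  counts : (descents peaks turns : ℕ) → Counts

0ᶜ : Counts
0ᶜ = counts 0 0 0

infixl 6 _+ᶜ_
_+ᶜ_ : Counts → Counts → Counts
counts a b c +ᶜ counts a′ b′ c′ = counts (a + a′) (b + b′) (c + c′)

+ᶜ-identityˡ : ∀ k → 0ᶜ +ᶜ k ≡ k
+ᶜ-identityˡ (counts a b c) = refl

+ᶜ-identityʳ : ∀ k → k +ᶜ 0ᶜ ≡ k
+ᶜ-identityʳ (counts a b c) rewrite +-identityʳ a | +-identityʳ b | +-identityʳ c = refl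

shiftBy : Counts → Sig → Sig
shiftBy _              ε                = ε
shiftBy (counts a b c) (sg f l a′ b′ c′) = sg f l (a′ + a) (b′ + b) (c′ + c)

countsOf : Sig → Counts
countsOf ε              = 0ᶜ
countsOf (sg _ _ a b c) = counts a b c

data NonEmpty : Sig → Set where
  sg : ∀ {f l a b c} → NonEmpty (sg f l a b c)

∙-nonEmpty : ∀ {s} t → NonEmpty s → NonEmpty (s ∙ t)
∙-nonEmpty ε              sg = sg
∙-nonEmpty (sg _ _ _ _ _) sg = sg

shiftBy-identity : ∀ s → shiftBy 0ᶜ s ≡ s
shiftBy-identity ε                = refl
shiftBy-identity (sg f l a b c) rewrite +-identityʳ a | +-identityʳ b | +-identityʳ c = refl

private
  shuffle : ∀ j x y k k′ → j + ((x + k) + (y + k′)) ≡ (j + (x + y)) + (k + k′)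
  shuffle = solve-∀

shiftBy-∙ : ∀ {s t} k k′ → NonEmpty s → NonEmpty t → shiftBy k s ∙ shiftBy k′ t ≡ shiftBy (k +ᶜ k′) (s ∙ t)
shiftBy-∙ {sg f₁ l₁ a₁ b₁ c₁} {sg f₂ l₂ a₂ b₂ c₂} (counts a b c) (counts a′ b′ c′) sg sg
  rewrite shuffle 0 a₁ a₂ a a′ | shuffle (peakBit l₁ f₂) b₁ b₂ b b′ | shuffle (turnBit l₁ f₂) c₁ c₂ c c′ = refl

shiftBy-∙ˡ : ∀ {s} k t → NonEmpty s → shiftBy k s ∙ t ≡ shiftBy k (s ∙ t)
shiftBy-∙ˡ {s} k ε ne = trans (∙-identityʳ (shiftBy k s)) (cong (shiftBy k) (sym (∙-identityʳ s)))
shiftBy-∙ˡ {s} k t@(sg _ _ _ _ _) ne = begin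
  shiftBy k s ∙ t                 ≡⟨ cong (shiftBy k s ∙_) (shiftBy-identity t) ⟨
  shiftBy k s ∙ shiftBy 0ᶜ t      ≡⟨ shiftBy-∙ k 0ᶜ ne sg ⟩
  shiftBy (k +ᶜ 0ᶜ) (s ∙ t)       ≡⟨ cong (λ k′ → shiftBy k′ (s ∙ t)) (+ᶜ-identityʳ k) ⟩
  shiftBy k (s ∙ t)               ∎
  where open ≡-Reasoning

shiftBy-∙ʳ : ∀ {t} k s → NonEmpty t → s ∙ shiftBy k t ≡ shiftBy k (s ∙ t)
shiftBy-∙ʳ {t} k ε ne = refl
shiftBy-∙ʳ {t} k s@(sg _ _ _ _ _) ne = begin
  s ∙ shiftBy k t                 ≡⟨ cong (_∙ shiftBy k t) (shiftBy-identity s) ⟨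
  shiftBy 0ᶜ s ∙ shiftBy k t      ≡⟨ shiftBy-∙ 0ᶜ k sg ne ⟩
  shiftBy (0ᶜ +ᶜ k) (s ∙ t)       ≡⟨ cong (λ k′ → shiftBy k′ (s ∙ t)) (+ᶜ-identityˡ k) ⟩
  shiftBy k (s ∙ t)               ∎
  where open ≡-Reasoning

-- A slot of π with direction d contributes the letter d if its gap is empty, and otherwise the
-- factor (ascent, directions of the gap, descent), which starts with true and ends with false.
cellSig : Bool → Maybe Counts → Sig
cellSig d nothing               = letter d
cellSig _ (just (counts a b c)) = sg true false a b c

cellSig-nonEmpty : ∀ d c → NonEmpty (cellSig d c)
cellSig-nonEmpty d nothing               = sg
cellSig-nonEmpty d (just (counts _ _ _)) = sg

cellsSig : List Bool → List (Maybe Counts) → Sig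
cellsSig (d ∷ D) (c ∷ cs) = cellSig d c ∙ cellsSig D cs
cellsSig _       _        = ε

cellsSig-++ : ∀ D E cs ds → length cs ≡ length D → cellsSig (D ++ E) (cs ++ ds) ≡ cellsSig D cs ∙ cellsSig E ds
cellsSig-++ []      E []       ds _   = refl
cellsSig-++ (d ∷ D) E (c ∷ cs) ds len =
  trans (cong (cellSig d c ∙_) (cellsSig-++ D E cs ds (suc-injective len)))
        (sym (∙-assoc (cellSig d c) (cellsSig D cs) (cellsSig E ds)))

cellCounts : Maybe Counts → Counts
cellCounts nothing  = 0ᶜ
cellCounts (just k) = k

totalCounts : List (Maybe Counts) → Counts
totalCounts []       = 0ᶜ
totalCounts (c ∷ cs) = cellCounts c +ᶜ totalCounts cs

forgetCounts : Maybe Counts → Maybe Counts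
forgetCounts nothing  = nothing
forgetCounts (just _) = just 0ᶜ

cellSig-forgetCounts : ∀ d c → cellSig d c ≡ shiftBy (cellCounts c) (cellSig d (forgetCounts c))
cellSig-forgetCounts d nothing               = sym (shiftBy-identity (letter d))
cellSig-forgetCounts d (just (counts _ _ _)) = refl

cellsSig-forgetCounts : ∀ D cs → length cs ≡ length D → cellsSig D cs ≡ shiftBy (totalCounts cs) (cellsSig D (map forgetCounts cs))
cellsSig-forgetCounts [] [] _ = refl
cellsSig-forgetCounts (d ∷ []) (c ∷ []) _ = begin
  cellSig d c ∙ ε                                   ≡⟨ ∙-identityʳ (cellSig d c) ⟩
  cellSig d c                                       ≡⟨ cellSig-forgetCounts d c ⟩
  shiftBy (cellCounts c) (cellSig d (forgetCounts c))       ≡⟨ cong₂ shiftBy (sym (+ᶜ-identityʳ (cellCounts c))) (sym (∙-identityʳ _)) ⟩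
  shiftBy (cellCounts c +ᶜ 0ᶜ) (cellSig d (forgetCounts c) ∙ ε) ∎
  where open ≡-Reasoning
cellsSig-forgetCounts (d ∷ D@(d′ ∷ _)) (c ∷ cs@(c′ ∷ _)) len = begin
  cellSig d c ∙ cellsSig D cs
    ≡⟨ cong₂ _∙_ (cellSig-forgetCounts d c) (cellsSig-forgetCounts D cs (suc-injective len)) ⟩
  shiftBy (cellCounts c) (cellSig d (forgetCounts c)) ∙ shiftBy (totalCounts cs) (cellsSig D (map forgetCounts cs))
    ≡⟨ shiftBy-∙ (cellCounts c) (totalCounts cs) (cellSig-nonEmpty d (forgetCounts c)) (∙-nonEmpty _ (cellSig-nonEmpty d′ (forgetCounts c′))) ⟩
  shiftBy (cellCounts c +ᶜ totalCounts cs) (cellSig d (forgetCounts c) ∙ cellsSig D (map forgetCounts cs)) ∎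
  where open ≡-Reasoning
cellsSig-forgetCounts [] (_ ∷ _) ()
cellsSig-forgetCounts (_ ∷ _) [] ()
cellsSig-forgetCounts (_ ∷ []) (_ ∷ _ ∷ _) ()
cellsSig-forgetCounts (_ ∷ _ ∷ _) (_ ∷ []) ()

gapCell : List ℕ → Maybe Counts
gapCell []      = nothing
gapCell (y ∷ g) = just (countsOf (sig (slotDirs true (y ∷ g))))

sig-ascent⋯descent : ∀ W → ∃ λ a → ∃ λ b → ∃ λ c → sig (true ∷ W ++ false ∷ []) ≡ sg true false a b c
sig-ascent⋯descent W rewrite sig-++ W (false ∷ []) with sig W
... | ε              = _ , _ , _ , refl
... | sg _ _ _ _ _ = _ , _ , _ , refl

sig-slotDirs : ∀ d g → sig (slotDirs d g) ≡ cellSig d (gapCell g)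
sig-slotDirs d []      = ∙-identityʳ (letter d)
sig-slotDirs d (y ∷ g) with sig-ascent⋯descent (dirs (y ∷ g))
... | _ , _ , _ , eq rewrite eq = refl

sig-innerDirs : ∀ D I → length I ≡ length D → sig (innerDirs D I) ≡ cellsSig D (map gapCell I)
sig-innerDirs []      []      _   = refl
sig-innerDirs (d ∷ D) (g ∷ I) len =
  trans (sig-++ (slotDirs d g) (innerDirs D I))
        (cong₂ _∙_ (sig-slotDirs d g) (sig-innerDirs D I (suc-injective len)))

bareCell : Bool → Maybe Counts
bareCell true  = nothing
bareCell false = just 0ᶜ

forgetCounts-gapCell : ∀ I → map forgetCounts (map gapCell I) ≡ map bareCell (map null I)
forgetCounts-gapCell []            = refl
forgetCounts-gapCell ([] ∷ I)      = cong (_ ∷_) (forgetCounts-gapCell I)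
forgetCounts-gapCell ((_ ∷ _) ∷ I) = cong (_ ∷_) (forgetCounts-gapCell I)

gapCounts : List (List ℕ) → Counts
gapCounts I = totalCounts (map gapCell I)

gapCounts-nonEmptyGaps : ∀ I → gapCounts (nonEmptyGaps I) ≡ gapCounts I
gapCounts-nonEmptyGaps []            = refl
gapCounts-nonEmptyGaps ([] ∷ I)      = trans (gapCounts-nonEmptyGaps I) (sym (+ᶜ-identityˡ (gapCounts I)))
gapCounts-nonEmptyGaps ((y ∷ g) ∷ I) = cong (cellCounts (gapCell (y ∷ g)) +ᶜ_) (gapCounts-nonEmptyGaps I)

sig-innerDirs-skeleton : ∀ D I → length I ≡ length D →
                         sig (innerDirs D I) ≡ shiftBy (gapCounts I) (cellsSig D (map bareCell (map null I)))
sig-innerDirs-skeleton D I len = begin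
  sig (innerDirs D I)                                             ≡⟨ sig-innerDirs D I len ⟩
  cellsSig D (map gapCell I)                                      ≡⟨ cellsSig-forgetCounts D (map gapCell I) (trans (length-map gapCell I) len) ⟩
  shiftBy (gapCounts I) (cellsSig D (map forgetCounts (map gapCell I)))   ≡⟨ cong (shiftBy (gapCounts I) ∘ cellsSig D) (forgetCounts-gapCell I) ⟩
  shiftBy (gapCounts I) (cellsSig D (map bareCell (map null I)))  ∎
  where open ≡-Reasoning

cellsSig-descentRun : ∀ b cs → length cs ≡ suc b →
                      ∃ λ f → ∃ λ x → ∃ λ y → ∃ λ w → cellsSig (replicate (suc b) false) cs ≡ sg f false x y w
cellsSig-descentRun zero    (nothing ∷ [])               _ = _ , _ , _ , _ , refl
cellsSig-descentRun zero    (just (counts _ _ _) ∷ [])   _ = _ , _ , _ , _ , refl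
cellsSig-descentRun (suc b) (c ∷ cs) len with cellsSig-descentRun b cs (suc-injective len)
... | _ , _ , _ , _ , eq rewrite eq with c
...   | nothing               = _ , _ , _ , _ , refl
...   | just (counts _ _ _)   = _ , _ , _ , _ , refl

cellsSig-ascentRun : ∀ b cs → length cs ≡ suc b →
                     ∃ λ l → ∃ λ x → ∃ λ y → ∃ λ w → cellsSig (replicate (suc b) true) cs ≡ sg true l x y w
cellsSig-ascentRun zero    (nothing ∷ [])               _ = _ , _ , _ , _ , refl
cellsSig-ascentRun zero    (just (counts _ _ _) ∷ [])   _ = _ , _ , _ , _ , refl
cellsSig-ascentRun (suc b) (c ∷ cs) len with cellsSig-ascentRun b cs (suc-injective len)
... | _ , _ , _ , _ , eq rewrite eq with c
...   | nothing               = _ , _ , _ , _ , refl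
...   | just (counts _ _ _)   = _ , _ , _ , _ , refl

bareSig : Bool → Bool → Sig
bareSig d e = cellSig d (bareCell e)

shiftBy-inside : ∀ k t s u → NonEmpty s → t ∙ shiftBy k s ∙ u ≡ shiftBy k (t ∙ s ∙ u)
shiftBy-inside k t s u ne = trans (cong (t ∙_) (shiftBy-∙ˡ k u ne)) (shiftBy-∙ʳ k t (∙-nonEmpty u ne))

rotationAsc-bare : ∀ e₀ e₁ e₂ f →
  bareSig true e₀ ∙ sg f false 0 0 0 ∙ bareSig true e₁ ∙ bareSig true e₂ ∙ ε ≡
  bareSig true e₁ ∙ bareSig true e₀ ∙ sg f false 0 0 0 ∙ bareSig true e₂ ∙ ε
rotationAsc-bare true  true  true  true  = refl
rotationAsc-bare true  true  true  false = refl
rotationAsc-bare true  true  false true  = refl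
rotationAsc-bare true  true  false false = refl
rotationAsc-bare true  false true  true  = refl
rotationAsc-bare true  false true  false = refl
rotationAsc-bare true  false false true  = refl
rotationAsc-bare true  false false false = refl
rotationAsc-bare false true  true  true  = refl
rotationAsc-bare false true  true  false = refl
rotationAsc-bare false true  false true  = refl
rotationAsc-bare false true  false false = refl
rotationAsc-bare false false true  true  = refl
rotationAsc-bare false false true  false = refl
rotationAsc-bare false false false true  = refl
rotationAsc-bare false false false false = refl

rotationDesc-bare : ∀ e₀ e₁ e₂ l →
  bareSig false e₀ ∙ sg true l 0 0 0 ∙ bareSig false e₁ ∙ bareSig false e₂ ∙ ε ≡
  bareSig false e₀ ∙ bareSig false e₂ ∙ sg true l 0 0 0 ∙ bareSig false e₁ ∙ ε
rotationDesc-bare true  true  true  true  = refl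
rotationDesc-bare true  true  true  false = refl
rotationDesc-bare true  true  false true  = refl
rotationDesc-bare true  true  false false = refl
rotationDesc-bare true  false true  true  = refl
rotationDesc-bare true  false true  false = refl
rotationDesc-bare true  false false true  = refl
rotationDesc-bare true  false false false = refl
rotationDesc-bare false true  true  true  = refl
rotationDesc-bare false true  true  false = refl
rotationDesc-bare false true  false true  = refl
rotationDesc-bare false true  false false = refl
rotationDesc-bare false false true  true  = refl
rotationDesc-bare false false true  false = refl
rotationDesc-bare false false false true  = refl
rotationDesc-bare false false false false = refl

-- The counts of the middle run factor out, which leaves the finite check rotationAsc-bare.
rotationAsc : ∀ e₀ e₁ e₂ f x y w →
  bareSig true e₀ ∙ sg f false x y w ∙ bareSig true e₁ ∙ bareSig true e₂ ∙ ε ≡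
  bareSig true e₁ ∙ bareSig true e₀ ∙ sg f false x y w ∙ bareSig true e₂ ∙ ε
rotationAsc e₀ e₁ e₂ f x y w = begin
  bareSig true e₀ ∙ shiftBy k s ∙ bareSig true e₁ ∙ bareSig true e₂ ∙ ε
    ≡⟨ shiftBy-inside k (bareSig true e₀) s (bareSig true e₁ ∙ bareSig true e₂ ∙ ε) sg ⟩
  shiftBy k (bareSig true e₀ ∙ s ∙ bareSig true e₁ ∙ bareSig true e₂ ∙ ε)
    ≡⟨ cong (shiftBy k) (rotationAsc-bare e₀ e₁ e₂ f) ⟩
  shiftBy k (bareSig true e₁ ∙ bareSig true e₀ ∙ s ∙ bareSig true e₂ ∙ ε)
    ≡⟨ shiftBy-∙ʳ k (bareSig true e₁) (∙-nonEmpty (s ∙ bareSig true e₂ ∙ ε) (cellSig-nonEmpty true (bareCell e₀))) ⟨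
  bareSig true e₁ ∙ shiftBy k (bareSig true e₀ ∙ s ∙ bareSig true e₂ ∙ ε)
    ≡⟨ cong (bareSig true e₁ ∙_) (shiftBy-inside k (bareSig true e₀) s (bareSig true e₂ ∙ ε) sg) ⟨
  bareSig true e₁ ∙ bareSig true e₀ ∙ shiftBy k s ∙ bareSig true e₂ ∙ ε ∎
  where
  open ≡-Reasoning
  k = counts x y w
  s = sg f false 0 0 0

rotationDesc : ∀ e₀ e₁ e₂ l x y w →
  bareSig false e₀ ∙ sg true l x y w ∙ bareSig false e₁ ∙ bareSig false e₂ ∙ ε ≡
  bareSig false e₀ ∙ bareSig false e₂ ∙ sg true l x y w ∙ bareSig false e₁ ∙ ε
rotationDesc e₀ e₁ e₂ l x y w = begin
  bareSig false e₀ ∙ shiftBy k s ∙ bareSig false e₁ ∙ bareSig false e₂ ∙ ε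
    ≡⟨ shiftBy-inside k (bareSig false e₀) s (bareSig false e₁ ∙ bareSig false e₂ ∙ ε) sg ⟩
  shiftBy k (bareSig false e₀ ∙ s ∙ bareSig false e₁ ∙ bareSig false e₂ ∙ ε)
    ≡⟨ cong (shiftBy k) (rotationDesc-bare e₀ e₁ e₂ l) ⟩
  shiftBy k (bareSig false e₀ ∙ bareSig false e₂ ∙ s ∙ bareSig false e₁ ∙ ε)
    ≡⟨ shiftBy-∙ʳ k (bareSig false e₀) (∙-nonEmpty (s ∙ bareSig false e₁ ∙ ε) (cellSig-nonEmpty false (bareCell e₂))) ⟨
  bareSig false e₀ ∙ shiftBy k (bareSig false e₂ ∙ s ∙ bareSig false e₁ ∙ ε)
    ≡⟨ cong (bareSig false e₀ ∙_) (shiftBy-inside k (bareSig false e₂) s (bareSig false e₁ ∙ ε) sg) ⟨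
  bareSig false e₀ ∙ bareSig false e₂ ∙ shiftBy k s ∙ bareSig false e₁ ∙ ε ∎
  where
  open ≡-Reasoning
  k = counts x y w
  s = sg true l 0 0 0

-- The directions of π from the last pair of birun ℓ-2 to the second pair of birun ℓ, where
-- X is the direction of the biruns ℓ-2 and ℓ, and b + 1 the number of pairs of birun ℓ-1;
-- region′ is the same stretch of π′ ∈ Ωℓ(π).
region region′ : Bool → ℕ → List Bool
region  X b = X ∷ replicate (suc b) (not X) ++ X ∷ X ∷ []
region′ X b = X ∷ X ∷ replicate (suc b) (not X) ++ X ∷ []

cellsSig-run : ∀ d b E rest es → length E ≡ suc b →
               cellsSig (replicate (suc b) d ++ rest) (map bareCell (E ++ es)) ≡
               cellsSig (replicate (suc b) d) (map bareCell E) ∙ cellsSig rest (map bareCell es)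
cellsSig-run d b E rest es |E| =
  trans (cong (cellsSig (replicate (suc b) d ++ rest)) (map-++ bareCell E es))
        (cellsSig-++ (replicate (suc b) d) rest (map bareCell E) (map bareCell es)
                     (trans (length-map bareCell E) (trans |E| (sym (length-replicate (suc b))))))

regionAsc-skeleton : ∀ b e₀ E e₁ e₂ → length E ≡ suc b →
                     cellsSig (region true b) (map bareCell (e₀ ∷ E ++ e₁ ∷ e₂ ∷ [])) ≡
                     cellsSig (region′ true b) (map bareCell (e₁ ∷ e₀ ∷ E ++ e₂ ∷ []))
regionAsc-skeleton b e₀ E e₁ e₂ |E| with cellsSig-descentRun b (map bareCell E) (trans (length-map bareCell E) |E|)
... | f , x , y , w , M≡ = begin
  bareSig true e₀ ∙ cellsSig (replicate (suc b) false ++ true ∷ true ∷ []) (map bareCell (E ++ e₁ ∷ e₂ ∷ []))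
    ≡⟨ cong (bareSig true e₀ ∙_) (cellsSig-run false b E (true ∷ true ∷ []) (e₁ ∷ e₂ ∷ []) |E|) ⟩
  bareSig true e₀ ∙ M ∙ bareSig true e₁ ∙ bareSig true e₂ ∙ ε
    ≡⟨ cong (λ s → bareSig true e₀ ∙ s ∙ bareSig true e₁ ∙ bareSig true e₂ ∙ ε) M≡ ⟩
  bareSig true e₀ ∙ sg f false x y w ∙ bareSig true e₁ ∙ bareSig true e₂ ∙ ε
    ≡⟨ rotationAsc e₀ e₁ e₂ f x y w ⟩
  bareSig true e₁ ∙ bareSig true e₀ ∙ sg f false x y w ∙ bareSig true e₂ ∙ ε
    ≡⟨ cong (λ s → bareSig true e₁ ∙ bareSig true e₀ ∙ s ∙ bareSig true e₂ ∙ ε) M≡ ⟨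
  bareSig true e₁ ∙ bareSig true e₀ ∙ M ∙ bareSig true e₂ ∙ ε
    ≡⟨ cong (λ s → bareSig true e₁ ∙ bareSig true e₀ ∙ s) (cellsSig-run false b E (true ∷ []) (e₂ ∷ []) |E|) ⟨
  bareSig true e₁ ∙ bareSig true e₀ ∙ cellsSig (replicate (suc b) false ++ true ∷ []) (map bareCell (E ++ e₂ ∷ [])) ∎
  where
  open ≡-Reasoning
  M = cellsSig (replicate (suc b) false) (map bareCell E)

regionDesc-skeleton : ∀ b e₀ E e₁ e₂ → length E ≡ suc b →
                      cellsSig (region false b) (map bareCell (e₀ ∷ E ++ e₁ ∷ e₂ ∷ [])) ≡
                      cellsSig (region′ false b) (map bareCell (e₀ ∷ e₂ ∷ E ++ e₁ ∷ []))
regionDesc-skeleton b e₀ E e₁ e₂ |E| with cellsSig-ascentRun b (map bareCell E) (trans (length-map bareCell E) |E|)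
... | l , x , y , w , M≡ = begin
  bareSig false e₀ ∙ cellsSig (replicate (suc b) true ++ false ∷ false ∷ []) (map bareCell (E ++ e₁ ∷ e₂ ∷ []))
    ≡⟨ cong (bareSig false e₀ ∙_) (cellsSig-run true b E (false ∷ false ∷ []) (e₁ ∷ e₂ ∷ []) |E|) ⟩
  bareSig false e₀ ∙ M ∙ bareSig false e₁ ∙ bareSig false e₂ ∙ ε
    ≡⟨ cong (λ s → bareSig false e₀ ∙ s ∙ bareSig false e₁ ∙ bareSig false e₂ ∙ ε) M≡ ⟩
  bareSig false e₀ ∙ sg true l x y w ∙ bareSig false e₁ ∙ bareSig false e₂ ∙ ε
    ≡⟨ rotationDesc e₀ e₁ e₂ l x y w ⟩
  bareSig false e₀ ∙ bareSig false e₂ ∙ sg true l x y w ∙ bareSig false e₁ ∙ ε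
    ≡⟨ cong (λ s → bareSig false e₀ ∙ bareSig false e₂ ∙ s ∙ bareSig false e₁ ∙ ε) M≡ ⟨
  bareSig false e₀ ∙ bareSig false e₂ ∙ M ∙ bareSig false e₁ ∙ ε
    ≡⟨ cong (λ s → bareSig false e₀ ∙ bareSig false e₂ ∙ s) (cellsSig-run true b E (false ∷ []) (e₁ ∷ []) |E|) ⟨
  bareSig false e₀ ∙ bareSig false e₂ ∙ cellsSig (replicate (suc b) true ++ false ∷ []) (map bareCell (E ++ e₁ ∷ [])) ∎
  where
  open ≡-Reasoning
  M = cellsSig (replicate (suc b) true) (map bareCell E)

-- The rotated window of gaps: it leaves out the first slot of the region when X = false and the
-- last one when X = true.
windowBefore windowAfter : Bool → ℕ
windowBefore true  = 0
windowBefore false = 1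
windowAfter  true  = 1
windowAfter  false = 0

region-skeleton : ∀ X b (P A : List Bool) z Q →
                  length P ≡ windowBefore X → length A ≡ suc (suc b) → length Q ≡ windowAfter X →
                  cellsSig (region X b) (map bareCell (P ++ A ++ z ∷ Q)) ≡
                  cellsSig (region′ X b) (map bareCell (P ++ z ∷ A ++ Q))
region-skeleton true  b [] (e₀ ∷ E) z (e₂ ∷ []) _ |A| _ = regionAsc-skeleton b e₀ E z e₂ (suc-injective |A|)
region-skeleton false b (e₀ ∷ []) A z [] _ |A| _ with initLast A
... | E ∷ʳ′ e₁ = begin
  cellsSig (region false b) (map bareCell (e₀ ∷ (E ++ e₁ ∷ []) ++ z ∷ []))
    ≡⟨ cong (λ A′ → cellsSig (region false b) (map bareCell (e₀ ∷ A′))) (++-assoc E (e₁ ∷ []) (z ∷ [])) ⟩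
  cellsSig (region false b) (map bareCell (e₀ ∷ E ++ e₁ ∷ z ∷ []))
    ≡⟨ regionDesc-skeleton b e₀ E e₁ z |E| ⟩
  cellsSig (region′ false b) (map bareCell (e₀ ∷ z ∷ E ++ e₁ ∷ []))
    ≡⟨ cong (λ A′ → cellsSig (region′ false b) (map bareCell (e₀ ∷ z ∷ A′))) (++-identityʳ (E ++ e₁ ∷ [])) ⟨
  cellsSig (region′ false b) (map bareCell (e₀ ∷ z ∷ (E ++ e₁ ∷ []) ++ [])) ∎
  where
  open ≡-Reasoning
  |E| : length E ≡ suc b
  |E| = suc-injective (trans (trans (+-comm 1 (length E)) (sym (length-++ E))) |A|)

length-region : ∀ X b → length (region X b) ≡ 4 + b
length-region X b = cong suc (begin
  length (replicate (suc b) (not X) ++ X ∷ X ∷ [])   ≡⟨ length-++ (replicate (suc b) (not X)) ⟩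
  length (replicate (suc b) (not X)) + 2            ≡⟨ cong (_+ 2) (length-replicate (suc b)) ⟩
  suc b + 2                                         ≡⟨ +-comm (suc b) 2 ⟩
  3 + b                                             ∎)
  where open ≡-Reasoning

length-region′ : ∀ X b → length (region′ X b) ≡ 4 + b
length-region′ X b = cong (suc ∘ suc) (begin
  length (replicate (suc b) (not X) ++ X ∷ [])       ≡⟨ length-++ (replicate (suc b) (not X)) ⟩
  length (replicate (suc b) (not X)) + 1            ≡⟨ cong (_+ 1) (length-replicate (suc b)) ⟩
  suc b + 1                                         ≡⟨ +-comm (suc b) 1 ⟩
  2 + b                                             ∎)
  where open ≡-Reasoning

length-window : ∀ {Y : Set} X b (P A : List Y) z Q →
                length P ≡ windowBefore X → length A ≡ suc (suc b) → length Q ≡ windowAfter X →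
                length (P ++ A ++ z ∷ Q) ≡ 4 + b
length-window X b P A z Q |P| |A| |Q| = begin
  length (P ++ A ++ z ∷ Q)                               ≡⟨ length-++ P ⟩
  length P + length (A ++ z ∷ Q)                         ≡⟨ cong (length P +_) (length-++ A) ⟩
  length P + (length A + suc (length Q))                 ≡⟨ cong₂ (λ p aq → p + aq) |P| (cong₂ (λ a q → a + suc q) |A| |Q|) ⟩
  windowBefore X + (suc (suc b) + suc (windowAfter X))   ≡⟨ arithmetic X ⟩
  4 + b                                                  ∎
  where
  open ≡-Reasoning
  arithmetic : ∀ X → windowBefore X + (suc (suc b) + suc (windowAfter X)) ≡ 4 + b
  arithmetic true  = +-comm (suc (suc b)) 2
  arithmetic false = cong suc (+-comm (suc (suc b)) 1)

sig-region-rotated : ∀ X b (P A : List (List ℕ)) z Q →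
                     length P ≡ windowBefore X → length A ≡ suc (suc b) → length Q ≡ windowAfter X →
                     sig (innerDirs (region′ X b) (P ++ rotateIn A z ++ Q)) ≡ sig (innerDirs (region X b) (P ++ A ++ z ∷ Q))
sig-region-rotated X b P A z Q |P| |A| |Q| = begin
  sig (innerDirs (region′ X b) R)
    ≡⟨ sig-innerDirs-skeleton (region′ X b) R (trans (length-rotated P A z Q) (trans |U| (sym (length-region′ X b)))) ⟩
  shiftBy (gapCounts R) (cellsSig (region′ X b) (map bareCell (map null R)))
    ≡⟨ cong₂ (λ k p → shiftBy k (cellsSig (region′ X b) (map bareCell p))) counts≡ nullsR ⟩
  shiftBy (gapCounts U) (cellsSig (region′ X b) (map bareCell (map null P ++ null z ∷ map null A ++ map null Q)))
    ≡⟨ cong (shiftBy (gapCounts U)) (region-skeleton X b (map null P) (map null A) (null z) (map null Q)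
              (trans (length-map null P) |P|) (trans (length-map null A) |A|) (trans (length-map null Q) |Q|)) ⟨
  shiftBy (gapCounts U) (cellsSig (region X b) (map bareCell (map null P ++ map null A ++ null z ∷ map null Q)))
    ≡⟨ cong (λ p → shiftBy (gapCounts U) (cellsSig (region X b) (map bareCell p))) nullsU ⟨
  shiftBy (gapCounts U) (cellsSig (region X b) (map bareCell (map null U)))
    ≡⟨ sig-innerDirs-skeleton (region X b) U (trans |U| (sym (length-region X b))) ⟨
  sig (innerDirs (region X b) U) ∎
  where
  open ≡-Reasoning
  R = P ++ rotateIn A z ++ Q
  U = P ++ A ++ z ∷ Q
  |U| : length U ≡ 4 + b
  |U| = length-window X b P A z Q |P| |A| |Q|
  counts≡ : gapCounts R ≡ gapCounts U
  counts≡ = trans (sym (gapCounts-nonEmptyGaps R)) (trans (cong gapCounts (nonEmptyGaps-rotated P A z Q)) (gapCounts-nonEmptyGaps U))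
  nullsR : map null R ≡ map null P ++ null z ∷ map null A ++ map null Q
  nullsR = trans (map-++ null P _) (cong (map null P ++_)
             (trans (map-++ null (rotateIn A z) Q) (cong (_++ map null Q) (null-rotateIn A z))))
  nullsU : map null U ≡ map null P ++ map null A ++ null z ∷ map null Q
  nullsU = trans (map-++ null P _) (cong (map null P ++_) (map-++ null A (z ∷ Q)))

StatPreservingBijection : (π π′ σ : List ℕ) → Set
StatPreservingBijection π π′ σ =
  ∃ λ (φ : List ℕ → List ℕ) →
    (∀ τ → InS π σ τ →
      InS π′ σ (φ τ) × udr (φ τ) ≡ udr τ × pk (φ τ) ≡ pk τ × des (φ τ) ≡ des τ)
    × (∀ τ₁ τ₂ → InS π σ τ₁ → InS π σ τ₂ → φ τ₁ ≡ φ τ₂ → τ₁ ≡ τ₂)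
    × (∀ ρ → InS π′ σ ρ → ∃ λ τ → InS π σ τ × φ τ ≡ ρ)

Unique-resp-↭ : ∀ {xs ys : List ℕ} → xs ↭ ys → Unique xs → Unique ys
Unique-resp-↭ p = PermutationSetoid.Unique-resp-↭ (≡.setoid ℕ) (↭⇒↭ₛ p)

nonEmpty-⊆ : ∀ {xs ys : List ℕ} → xs ⊆ ys → xs ≢ [] → ys ≢ []
nonEmpty-⊆ [] xs≢[] refl = xs≢[] refl

module _ {π σ τ : List ℕ} (τ∈S : InS π σ τ) where

  InS-unique : Unique (π ++ σ) → Unique τ
  InS-unique = Unique-resp-↭ (↭-sym (proj₁ τ∈S))

  InS-positive : All (0 <_) (π ++ σ) → All (0 <_) τ
  InS-positive = All-resp-↭ (↭-sym (proj₁ τ∈S))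

GapsFor-resp : ∀ {n u u′ L L′} → concat L′ ≡ concat L → length L′ ≡ length L → length u′ ≡ length u →
               GapsFor n u L → GapsFor n u′ L′
GapsFor-resp {n} concat≡ length≡ |u′| (big , len) =
  All.concat⁻ (subst (All (_≰ n)) (sym concat≡) (All.concat⁺ big)) ,
  trans length≡ (trans len (cong suc (sym |u′|)))

module _ {n : ℕ} {π σ : List ℕ} (π≤n : All (_≤ n) π) (σ≰n : All (_≰ n) σ) where

  gaps-InS : ∀ {τ} → InS π σ τ → GapsFor n π (gaps n τ) × concat (gaps n τ) ≡ σ
  gaps-InS {τ} τ∈S with InS⇒smalls∧bigs π≤n σ≰n τ∈S
  ... | smalls≡ , bigs≡ = subst (λ u → GapsFor n u (gaps n τ)) smalls≡ (gaps-GapsFor τ) , trans (concat-gaps τ) bigs≡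

  fillGaps-gaps-InS : ∀ {τ} → InS π σ τ → fillGaps π (gaps n τ) ≡ τ
  fillGaps-gaps-InS {τ} τ∈S = trans (cong (λ u → fillGaps u (gaps n τ)) (sym (proj₁ (InS⇒smalls∧bigs π≤n σ≰n τ∈S))))
                                    (fillGaps-gaps τ)

  fillGaps-InS : ∀ {L} → GapsFor n π L → concat L ≡ σ → InS π σ (fillGaps π L)
  fillGaps-InS gs concat≡ = smalls∧bigs⇒InS (smalls-fillGaps π≤n gs) (trans (bigs-fillGaps π≤n gs) concat≡)

module WindowRotation
  {n : ℕ} {π π′ σ : List ℕ} (π≤n : All (_≤ n) π) (π′≤n : All (_≤ n) π′) (σ≰n : All (_≰ n) σ)
  (|π′| : length π′ ≡ length π) (j a : ℕ) (fits : j + suc a ≤ suc (length π)) where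

  φ ψ : List ℕ → List ℕ
  φ τ = fillGaps π′ (rotateWindow j a (gaps n τ))
  ψ ρ = fillGaps π  (unrotateWindow j a (gaps n ρ))

  record Window : Set where
    constructor window
    field
      P A : List (List ℕ)
      z   : List ℕ
      Q   : List (List ℕ)
      |P| : length P ≡ j
      |A| : length A ≡ a

  unrotated rotated : Window → List (List ℕ)
  unrotated (window P A z Q _ _) = P ++ A ++ z ∷ Q
  rotated   (window P A z Q _ _) = P ++ rotateIn A z ++ Q

  rotateWindow-unrotated : ∀ w → rotateWindow j a (unrotated w) ≡ rotated w
  rotateWindow-unrotated (window P A z Q |P| |A|) = rotateWindow-view P A z Q |P| |A|

  unrotateWindow-rotated : ∀ w → unrotateWindow j a (rotated w) ≡ unrotated w
  unrotateWindow-rotated (window P A z Q |P| |A|) = unrotateWindow-view P A z Q |P| |A|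

  concat-rotated-window : ∀ w → concat (rotated w) ≡ concat (unrotated w)
  concat-rotated-window (window P A z Q _ _) = concat-rotated P A z Q

  length-rotated-window : ∀ w → length (rotated w) ≡ length (unrotated w)
  length-rotated-window (window P A z Q _ _) = length-rotated P A z Q

  GapsFor-rotated : ∀ w → GapsFor n π (unrotated w) → GapsFor n π′ (rotated w)
  GapsFor-rotated w = GapsFor-resp {u = π} {u′ = π′} (concat-rotated-window w) (length-rotated-window w) |π′|

  GapsFor-unrotated : ∀ w → GapsFor n π′ (rotated w) → GapsFor n π (unrotated w)
  GapsFor-unrotated w = GapsFor-resp {u = π′} {u′ = π} (sym (concat-rotated-window w)) (sym (length-rotated-window w)) (sym |π′|)

  SigRotation : Set
  SigRotation = ∀ L → GapsFor n π L → sig (dirs (fillGaps π′ (rotateWindow j a L))) ≡ sig (dirs (fillGaps π L))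

  unrotatedWindow : ∀ {τ} → InS π σ τ → ∃ λ w → gaps n τ ≡ unrotated w
  unrotatedWindow {τ} τ∈S with windowView j a (gaps n τ) (subst (j + suc a ≤_) (sym |gaps|) fits)
    where
    |gaps| : length (gaps n τ) ≡ suc (length π)
    |gaps| = proj₂ (proj₁ (gaps-InS π≤n σ≰n {τ} τ∈S))
  ... | P , A , z , Q , L≡ , |P| , |A| = window P A z Q |P| |A| , L≡

  rotatedWindow : ∀ {ρ} → InS π′ σ ρ → ∃ λ w → gaps n ρ ≡ rotated w
  rotatedWindow {ρ} ρ∈S with rotatedView j a (gaps n ρ) (subst (j + suc a ≤_) (sym |gaps|) fits)
    where
    |gaps| : length (gaps n ρ) ≡ suc (length π)
    |gaps| = trans (proj₂ (proj₁ (gaps-InS π′≤n σ≰n {ρ} ρ∈S))) (cong suc |π′|)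
  ... | P , A , z , Q , L≡ , |P| , |A| = window P A z Q |P| |A| , L≡

  module _ {τ : List ℕ} (τ∈S : InS π σ τ) where

    private
      w = proj₁ (unrotatedWindow τ∈S)
      gaps≡ = proj₂ (unrotatedWindow τ∈S)
      gapsFor : GapsFor n π (unrotated w)
      gapsFor = subst (GapsFor n π) gaps≡ (proj₁ (gaps-InS π≤n σ≰n τ∈S))

    φ-unrotated : φ τ ≡ fillGaps π′ (rotated w)
    φ-unrotated = cong (fillGaps π′) (trans (cong (rotateWindow j a) gaps≡) (rotateWindow-unrotated w))

    τ-unrotated : τ ≡ fillGaps π (unrotated w)
    τ-unrotated = trans (sym (fillGaps-gaps-InS π≤n σ≰n τ∈S)) (cong (fillGaps π) gaps≡)

    φ-InS : InS π′ σ (φ τ)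
    φ-InS = subst (InS π′ σ) (sym φ-unrotated)
      (fillGaps-InS π′≤n σ≰n (GapsFor-rotated w gapsFor)
        (trans (concat-rotated-window w) (trans (cong concat (sym gaps≡)) (proj₂ (gaps-InS π≤n σ≰n τ∈S)))))

    φ-sig : SigRotation → sig (dirs (φ τ)) ≡ sig (dirs τ)
    φ-sig sig-rotation = trans (sig-rotation (gaps n τ) (proj₁ (gaps-InS π≤n σ≰n τ∈S)))
                               (cong (sig ∘ dirs) (fillGaps-gaps-InS π≤n σ≰n τ∈S))

    ψ-φ : ψ (φ τ) ≡ τ
    ψ-φ = begin
      ψ (φ τ)                                                   ≡⟨ cong ψ φ-unrotated ⟩
      fillGaps π (unrotateWindow j a (gaps n (fillGaps π′ (rotated w))))
                                                                ≡⟨ cong (fillGaps π ∘ unrotateWindow j a)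
                                                                        (gaps-fillGaps π′≤n (GapsFor-rotated w gapsFor)) ⟩
      fillGaps π (unrotateWindow j a (rotated w))               ≡⟨ cong (fillGaps π) (unrotateWindow-rotated w) ⟩
      fillGaps π (unrotated w)                                  ≡⟨ τ-unrotated ⟨
      τ                                                         ∎
      where open ≡-Reasoning

  module _ {ρ : List ℕ} (ρ∈S : InS π′ σ ρ) where

    private
      w = proj₁ (rotatedWindow ρ∈S)
      gaps≡ = proj₂ (rotatedWindow ρ∈S)
      gapsFor : GapsFor n π (unrotated w)
      gapsFor = GapsFor-unrotated w (subst (GapsFor n π′) gaps≡ (proj₁ (gaps-InS π′≤n σ≰n ρ∈S)))

    ψ-rotated : ψ ρ ≡ fillGaps π (unrotated w)
    ψ-rotated = cong (fillGaps π) (trans (cong (unrotateWindow j a) gaps≡) (unrotateWindow-rotated w))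

    ψ-InS : InS π σ (ψ ρ)
    ψ-InS = subst (InS π σ) (sym ψ-rotated)
      (fillGaps-InS π≤n σ≰n gapsFor
        (trans (sym (concat-rotated-window w)) (trans (cong concat (sym gaps≡)) (proj₂ (gaps-InS π′≤n σ≰n ρ∈S)))))

    φ-ψ : φ (ψ ρ) ≡ ρ
    φ-ψ = begin
      φ (ψ ρ)                                                   ≡⟨ cong φ ψ-rotated ⟩
      fillGaps π′ (rotateWindow j a (gaps n (fillGaps π (unrotated w))))
                                                                ≡⟨ cong (fillGaps π′ ∘ rotateWindow j a) (gaps-fillGaps π≤n gapsFor) ⟩
      fillGaps π′ (rotateWindow j a (unrotated w))              ≡⟨ cong (fillGaps π′) (rotateWindow-unrotated w) ⟩
      fillGaps π′ (rotated w)                                   ≡⟨ cong (fillGaps π′) gaps≡ ⟨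
      fillGaps π′ (gaps n ρ)                                    ≡⟨ fillGaps-gaps-InS π′≤n σ≰n ρ∈S ⟩
      ρ                                                         ∎
      where open ≡-Reasoning

  statPreservingBijection : SigRotation → Unique (π ++ σ) → Unique (π′ ++ σ) →
                            All (0 <_) (π ++ σ) → All (0 <_) (π′ ++ σ) → π ≢ [] → π′ ≢ [] →
                            StatPreservingBijection π π′ σ
  statPreservingBijection sig-rotation uniq uniq′ pos pos′ π≢[] π′≢[] =
    φ ,
    (λ τ τ∈S → φ-InS τ∈S ,
      sig-determines-stats (AllPairs⇒Linked (InS-unique (φ-InS τ∈S) uniq′)) (AllPairs⇒Linked (InS-unique τ∈S uniq))
                           (InS-positive (φ-InS τ∈S) pos′) (InS-positive τ∈S pos)
                           (nonEmpty-⊆ (proj₁ (proj₂ (φ-InS τ∈S))) π′≢[]) (nonEmpty-⊆ (proj₁ (proj₂ τ∈S)) π≢[])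
                           (φ-sig τ∈S sig-rotation)) ,
    (λ τ₁ τ₂ τ₁∈S τ₂∈S φτ₁≡φτ₂ → trans (sym (ψ-φ τ₁∈S)) (trans (cong ψ φτ₁≡φτ₂) (ψ-φ τ₂∈S))) ,
    (λ ρ ρ∈S → ψ ρ , ψ-InS ρ∈S , φ-ψ ρ∈S)

decode : Bool → List ℕ → List Bool
decode d []       = []
decode d (k ∷ ks) = replicate k d ++ decode (not d) ks

replicate-snoc : ∀ k (d : Bool) D → replicate (suc k) d ++ D ≡ replicate k d ++ d ∷ D
replicate-snoc zero    d D = refl
replicate-snoc (suc k) d D = cong (d ∷_) (replicate-snoc k d D)

decode-blocksFrom : ∀ d k D → decode d (blocksFrom d k D) ≡ replicate k d ++ D
decode-blocksFrom d     k []          = refl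
decode-blocksFrom true  k (true ∷ D)  = trans (decode-blocksFrom true (suc k) D) (replicate-snoc k true D)
decode-blocksFrom false k (false ∷ D) = trans (decode-blocksFrom false (suc k) D) (replicate-snoc k false D)
decode-blocksFrom true  k (false ∷ D) = cong (replicate k true ++_) (decode-blocksFrom false 1 D)
decode-blocksFrom false k (true ∷ D)  = cong (replicate k false ++_) (decode-blocksFrom true 1 D)

blocksFrom-positive : ∀ d k D → 0 < k → All (0 <_) (blocksFrom d k D)
blocksFrom-positive d     k []          0<k = 0<k ∷ []
blocksFrom-positive true  k (true ∷ D)  0<k = blocksFrom-positive true (suc k) D (m≤n⇒m≤1+n 0<k)
blocksFrom-positive false k (false ∷ D) 0<k = blocksFrom-positive false (suc k) D (m≤n⇒m≤1+n 0<k)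
blocksFrom-positive true  k (false ∷ D) 0<k = 0<k ∷ blocksFrom-positive false 1 D ≤-refl
blocksFrom-positive false k (true ∷ D)  0<k = 0<k ∷ blocksFrom-positive true 1 D ≤-refl

flips : ℕ → Bool → Bool
flips zero    d = d
flips (suc k) d = flips k (not d)

decode-++ : ∀ d ks ks′ → decode d (ks ++ ks′) ≡ decode d ks ++ decode (flips (length ks) d) ks′
decode-++ d []       ks′ = refl
decode-++ d (k ∷ ks) ks′ =
  trans (cong (replicate k d ++_) (decode-++ (not d) ks ks′)) (sym (++-assoc (replicate k d) (decode (not d) ks) _))

replicate-region : ∀ X a b c R →
  replicate (suc a) X ++ replicate (suc b) (not X) ++ replicate (suc (suc c)) X ++ R ≡ replicate a X ++ region X b ++ replicate c X ++ R
replicate-region X (suc a) b c R = cong (X ∷_) (replicate-region X a b c R)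
replicate-region X zero    b c R = cong (X ∷_) (sym (++-assoc (replicate (suc b) (not X)) (X ∷ X ∷ []) (replicate c X ++ R)))

replicate-region′ : ∀ X a b c R →
  replicate (suc (suc a)) X ++ replicate (suc b) (not X) ++ replicate (suc c) X ++ R ≡ replicate a X ++ region′ X b ++ replicate c X ++ R
replicate-region′ X (suc a) b c R = cong (X ∷_) (replicate-region′ X a b c R)
replicate-region′ X zero    b c R = cong (λ D → X ∷ X ∷ D) (sym (++-assoc (replicate (suc b) (not X)) (X ∷ []) (replicate c X ++ R)))

decode-region : ∀ X a b c post → ∃ λ R →
  decode X (suc a ∷ suc b ∷ suc (suc c) ∷ post) ≡ replicate a X ++ region X b ++ replicate c X ++ R ×
  decode X (suc (suc a) ∷ suc b ∷ suc c ∷ post) ≡ replicate a X ++ region′ X b ++ replicate c X ++ R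
decode-region true  a b c post = decode false post , replicate-region true a b c _ , replicate-region′ true a b c _
decode-region false a b c post = decode true post , replicate-region false a b c _ , replicate-region′ false a b c _

dirs-shape : ∀ d D D′ pre a b c post →
  blocks (d ∷ D) ≡ pre ++ a ∷ b ∷ suc (suc c) ∷ post → blocks (d ∷ D′) ≡ pre ++ suc a ∷ b ∷ suc c ∷ post →
  ∃ λ dP → ∃ λ dS → ∃ λ b′ → ∃ λ X → d ∷ D ≡ dP ++ region X b′ ++ dS × d ∷ D′ ≡ dP ++ region′ X b′ ++ dS
dirs-shape d D D′ pre a b c post blocks≡ blocks′≡
  with All.++⁻ʳ pre (subst (All (0 <_)) blocks≡ (blocksFrom-positive d 1 D ≤-refl))
... | s≤s {n = a′} _ ∷ s≤s {n = b′} _ ∷ _ with decode-region (flips (length pre) d) a′ b′ c post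
... | R , shape , shape′ =
  decode d pre ++ replicate a′ X , replicate c X ++ R , b′ , X ,
  from-blocks {S = region X b′} blocks≡ shape , from-blocks {S = region′ X b′} blocks′≡ shape′
  where
  X = flips (length pre) d
  from-blocks : ∀ {D ks S} → blocks (d ∷ D) ≡ pre ++ ks → decode X ks ≡ replicate a′ X ++ S ++ replicate c X ++ R →
                d ∷ D ≡ (decode d pre ++ replicate a′ X) ++ S ++ replicate c X ++ R
  from-blocks {D} {ks} {S} blocks≡ shape = begin
    d ∷ D                                                  ≡⟨ decode-blocksFrom d 1 D ⟨
    decode d (blocks (d ∷ D))                              ≡⟨ cong (decode d) blocks≡ ⟩
    decode d (pre ++ ks)                                   ≡⟨ decode-++ d pre ks ⟩
    decode d pre ++ decode X ks                            ≡⟨ cong (decode d pre ++_) shape ⟩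
    decode d pre ++ replicate a′ X ++ S ++ replicate c X ++ R ≡⟨ ++-assoc (decode d pre) (replicate a′ X) _ ⟨
    (decode d pre ++ replicate a′ X) ++ S ++ replicate c X ++ R ∎
    where open ≡-Reasoning

module _ {Y : Set} where

  cut3 : ∀ j (L : List Y) → 3 + j ≤ length L →
         ∃ λ pre → ∃ λ y₀ → ∃ λ y₁ → ∃ λ y₂ → ∃ λ post → L ≡ pre ++ y₀ ∷ y₁ ∷ y₂ ∷ post × length pre ≡ j
  cut3 zero    (y₀ ∷ y₁ ∷ y₂ ∷ post) _ = [] , y₀ , y₁ , y₂ , post , refl , refl
  cut3 (suc j) (x ∷ L) (s≤s le) with cut3 j L le
  ... | pre , y₀ , y₁ , y₂ , post , L≡ , |pre| = x ∷ pre , y₀ , y₁ , y₂ , post , cong (x ∷_) L≡ , cong suc |pre|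
  cut3 zero    (_ ∷ [])     (s≤s ())
  cut3 zero    (_ ∷ _ ∷ []) (s≤s (s≤s ()))

nth-cut3 : ∀ {k} P (y₀ y₁ y₂ : ℕ) R → length P ≡ k → nth (P ++ y₀ ∷ y₁ ∷ y₂ ∷ R) (3 + k) ≡ y₂
nth-cut3 []      y₀ y₁ y₂ R refl = refl
nth-cut3 (x ∷ P) y₀ y₁ y₂ R refl = nth-cut3 P y₀ y₁ y₂ R refl

mapAt-cut3 : ∀ {k} P (y₀ y₁ y₂ : ℕ) R → length P ≡ k →
             mapAt k suc (mapAt (2 + k) pred (P ++ y₀ ∷ y₁ ∷ y₂ ∷ R)) ≡ P ++ suc y₀ ∷ y₁ ∷ pred y₂ ∷ R
mapAt-cut3 []      y₀ y₁ y₂ R refl = refl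
mapAt-cut3 (x ∷ P) y₀ y₁ y₂ R refl = cong (x ∷_) (mapAt-cut3 P y₀ y₁ y₂ R refl)

-- type π = map suc B for the lengths B of the runs of equal directions of π; Ωℓ moves one
-- direction from run ℓ to run ℓ-2.
blocks-Ω : ∀ (B B′ : List ℕ) ℓ → 3 ≤ ℓ → ℓ ≤ length (map suc B) → 3 ≤ nth (map suc B) ℓ →
           map suc B′ ≡ mapAt (ℓ ∸ 3) suc (mapAt (ℓ ∸ 1) pred (map suc B)) →
           ∃ λ pre → ∃ λ a → ∃ λ b → ∃ λ c → ∃ λ post →
             B ≡ pre ++ a ∷ b ∷ suc (suc c) ∷ post × B′ ≡ pre ++ suc a ∷ b ∷ suc c ∷ post
blocks-Ω B B′ (suc (suc (suc j))) _              ℓ≤ 3≤tℓ type′≡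
  with cut3 j B (subst (3 + j ≤_) (length-map suc B) ℓ≤)
... | pre , a , b , c₀ , post , refl , refl
  with c₀ | subst (3 ≤_) (trans (cong (λ T → nth T _) (map-++ suc pre (a ∷ b ∷ c₀ ∷ post)))
                                 (nth-cut3 (map suc pre) _ _ _ _ (length-map suc pre))) 3≤tℓ
... | suc (suc c) | _ = pre , a , b , c , post , refl , map-injective suc-injective (begin
  map suc B′                                                                   ≡⟨ type′≡ ⟩
  mapAt j suc (mapAt (2 + j) pred (map suc (pre ++ a ∷ b ∷ suc (suc c) ∷ post))) ≡⟨ cong (mapAt j suc ∘ mapAt (2 + j) pred)
                                                                                     (map-++ suc pre (a ∷ b ∷ suc (suc c) ∷ post)) ⟩
  mapAt j suc (mapAt (2 + j) pred (map suc pre ++ suc a ∷ suc b ∷ suc (suc (suc c)) ∷ map suc post))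
                                                                               ≡⟨ mapAt-cut3 (map suc pre) _ _ _ _ (length-map suc pre) ⟩
  map suc pre ++ suc (suc a) ∷ suc b ∷ suc (suc c) ∷ map suc post              ≡⟨ map-++ suc pre (suc a ∷ b ∷ suc c ∷ post) ⟨
  map suc (pre ++ suc a ∷ b ∷ suc c ∷ post)                                    ∎)
  where open ≡-Reasoning
... | zero        | s≤s ()
... | suc zero    | s≤s (s≤s ())
blocks-Ω _ _ 0                     ()                _ _ _
blocks-Ω _ _ 1                     (s≤s ())          _ _ _
blocks-Ω _ _ 2                     (s≤s (s≤s ()))    _ _ _

module _ {Y : Set} where

  lengthView : ∀ k m (L : List Y) → length L ≡ k + m →
               ∃ λ A → ∃ λ B → L ≡ A ++ B × length A ≡ k × length B ≡ m
  lengthView zero    m L       len = [] , L , refl , refl , len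
  lengthView (suc k) m (x ∷ L) len with lengthView k m L (suc-injective len)
  ... | A , B , L≡ , |A| , |B| = x ∷ A , B , cong (x ∷_) L≡ , cong suc |A| , |B|

  -- A list of gaps as seen from the region: I₁ for the slots of dP, then the region, whose
  -- slots hold P₀ ++ A ++ z ∷ Q₀ with A ++ z ∷ [] the rotated window, then I₃.
  regionView : ∀ X b k r (I : List Y) → length I ≡ k + ((4 + b) + r) →
               ∃ λ I₁ → ∃ λ P₀ → ∃ λ A → ∃ λ z → ∃ λ Q₀ → ∃ λ I₃ →
                 I ≡ I₁ ++ (P₀ ++ A ++ z ∷ Q₀) ++ I₃ × length I₁ ≡ k ×
                 length P₀ ≡ windowBefore X × length A ≡ suc (suc b) × length Q₀ ≡ windowAfter X
  regionView X b k r I len with lengthView k _ I len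
  ... | I₁ , R , refl , |I₁| , |R| with lengthView (4 + b) r R |R|
  ... | W , I₃ , refl , |W| , _ with lengthView (windowBefore X) _ W (trans |W| (split X))
    where
    split : ∀ X → 4 + b ≡ windowBefore X + (suc (suc b) + suc (windowAfter X))
    split true  = +-comm 2 (suc (suc b))
    split false = cong suc (+-comm 1 (suc (suc b)))
  ... | P₀ , R′ , refl , |P₀| , |R′| with lengthView (suc (suc b)) _ R′ |R′|
  ... | A , z ∷ Q₀ , refl , |A| , |zQ₀| = I₁ , P₀ , A , z , Q₀ , I₃ , refl , |I₁| , |P₀| , |A| , suc-injective |zQ₀|

sig-fillGaps-split : ∀ {n x u} dP D dS g₀ I₁ W I₃ → All (_≤ n) (x ∷ u) → dirs (x ∷ u) ≡ dP ++ D ++ dS →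
                     GapsFor n (x ∷ u) (g₀ ∷ I₁ ++ W ++ I₃) → length I₁ ≡ length dP → length W ≡ length D →
                     sig (dirs (fillGaps (x ∷ u) (g₀ ∷ I₁ ++ W ++ I₃))) ≡
                     sig (leadDirs g₀) ∙ sig (innerDirs dP I₁) ∙ sig (innerDirs D W) ∙ sig (gapDirs dS I₃)
sig-fillGaps-split {x = x} {u} dP D dS g₀ I₁ W I₃ π≤n dirs≡ gapsFor |I₁| |W| = begin
  sig (dirs (fillGaps (x ∷ u) (g₀ ∷ I₁ ++ W ++ I₃)))
    ≡⟨ cong sig (dirs-fillGaps π≤n gapsFor) ⟩
  sig (leadDirs g₀ ++ gapDirs (dirs (x ∷ u)) (I₁ ++ W ++ I₃))
    ≡⟨ cong (λ E → sig (leadDirs g₀ ++ gapDirs E (I₁ ++ W ++ I₃))) dirs≡ ⟩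
  sig (leadDirs g₀ ++ gapDirs (dP ++ D ++ dS) (I₁ ++ W ++ I₃))
    ≡⟨ cong (λ E → sig (leadDirs g₀ ++ E)) (trans (gapDirs-++ dP (D ++ dS) I₁ (W ++ I₃) |I₁|)
                                                   (cong (innerDirs dP I₁ ++_) (gapDirs-++ D dS W I₃ |W|))) ⟩
  sig (leadDirs g₀ ++ innerDirs dP I₁ ++ innerDirs D W ++ gapDirs dS I₃)
    ≡⟨ sig-++ (leadDirs g₀) _ ⟩
  sig (leadDirs g₀) ∙ sig (innerDirs dP I₁ ++ innerDirs D W ++ gapDirs dS I₃)
    ≡⟨ cong (sig (leadDirs g₀) ∙_) (trans (sig-++ (innerDirs dP I₁) _) (cong (sig (innerDirs dP I₁) ∙_) (sig-++ (innerDirs D W) _))) ⟩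
  sig (leadDirs g₀) ∙ sig (innerDirs dP I₁) ∙ sig (innerDirs D W) ∙ sig (gapDirs dS I₃) ∎
  where open ≡-Reasoning

length-dirs : ∀ x u → length (dirs (x ∷ u)) ≡ length u
length-dirs x []      = refl
length-dirs x (y ∷ u) = cong suc (length-dirs y u)

length-of-dirs : ∀ {x u} dP D dS {d} → dirs (x ∷ u) ≡ dP ++ D ++ dS → length D ≡ d →
                 length u ≡ length dP + (d + length dS)
length-of-dirs {x} {u} dP D dS {d} dirs≡ |D| = begin
  length u                                 ≡⟨ length-dirs x u ⟨
  length (dirs (x ∷ u))                    ≡⟨ cong length dirs≡ ⟩
  length (dP ++ D ++ dS)                   ≡⟨ length-++ dP ⟩
  length dP + length (D ++ dS)             ≡⟨ cong (length dP +_) (trans (length-++ D) (cong (_+ length dS) |D|)) ⟩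
  length dP + (d + length dS)              ∎
  where open ≡-Reasoning

reassoc : ∀ {Y : Set} (I₁ P₀ M Q₀ I₃ : List Y) → I₁ ++ (P₀ ++ M ++ Q₀) ++ I₃ ≡ (I₁ ++ P₀) ++ M ++ Q₀ ++ I₃
reassoc I₁ P₀ M Q₀ I₃ = begin
  I₁ ++ (P₀ ++ M ++ Q₀) ++ I₃      ≡⟨ cong (I₁ ++_) (++-assoc P₀ (M ++ Q₀) I₃) ⟩
  I₁ ++ P₀ ++ (M ++ Q₀) ++ I₃      ≡⟨ cong (λ R → I₁ ++ P₀ ++ R) (++-assoc M Q₀ I₃) ⟩
  I₁ ++ P₀ ++ M ++ Q₀ ++ I₃        ≡⟨ ++-assoc I₁ P₀ _ ⟨
  (I₁ ++ P₀) ++ M ++ Q₀ ++ I₃      ∎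
  where open ≡-Reasoning

module _ {n x u x′ u′} (dP dS : List Bool) (X : Bool) (b : ℕ)
  (π≤n : All (_≤ n) (x ∷ u)) (π′≤n : All (_≤ n) (x′ ∷ u′))
  (dirs≡ : dirs (x ∷ u) ≡ dP ++ region X b ++ dS) (dirs′≡ : dirs (x′ ∷ u′) ≡ dP ++ region′ X b ++ dS) where

  |u| : length u ≡ length dP + ((4 + b) + length dS)
  |u| = length-of-dirs {x} {u} dP (region X b) dS dirs≡ (length-region X b)

  |π′| : length (x′ ∷ u′) ≡ length (x ∷ u)
  |π′| = cong suc (trans (length-of-dirs {x′} {u′} dP (region′ X b) dS dirs′≡ (length-region′ X b)) (sym |u|))

  sig-rotateWindow : ∀ L → GapsFor n (x ∷ u) L →
    sig (dirs (fillGaps (x′ ∷ u′) (rotateWindow (suc (length dP + windowBefore X)) (suc (suc b)) L))) ≡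
    sig (dirs (fillGaps (x ∷ u) L))
  sig-rotateWindow (g₀ ∷ I) gapsFor@(_ , len)
    with regionView X b (length dP) (suc (length dS)) I
           (trans (suc-injective len) (trans (cong suc |u|) (sym (trans (cong (length dP +_) (+-suc (4 + b) (length dS)))
                                                                       (+-suc (length dP) _)))))
  ... | I₁ , P₀ , A , z , Q₀ , I₃ , refl , |I₁| , |P₀| , |A| , |Q₀| = begin
    sig (dirs (fillGaps (x′ ∷ u′) (rotateWindow j a (g₀ ∷ I₁ ++ W ++ I₃))))
      ≡⟨ cong (λ L → sig (dirs (fillGaps (x′ ∷ u′) L))) rotate≡ ⟩
    sig (dirs (fillGaps (x′ ∷ u′) (g₀ ∷ I₁ ++ W′ ++ I₃)))
      ≡⟨ sig-fillGaps-split dP (region′ X b) dS g₀ I₁ W′ I₃ π′≤n dirs′≡ gapsFor′ |I₁|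
           (trans (length-rotated P₀ A z Q₀) (trans (length-window X b P₀ A z Q₀ |P₀| |A| |Q₀|) (sym (length-region′ X b)))) ⟩
    sig (leadDirs g₀) ∙ sig (innerDirs dP I₁) ∙ sig (innerDirs (region′ X b) W′) ∙ sig (gapDirs dS I₃)
      ≡⟨ cong (λ s → sig (leadDirs g₀) ∙ sig (innerDirs dP I₁) ∙ s ∙ sig (gapDirs dS I₃))
              (sig-region-rotated X b P₀ A z Q₀ |P₀| |A| |Q₀|) ⟩
    sig (leadDirs g₀) ∙ sig (innerDirs dP I₁) ∙ sig (innerDirs (region X b) W) ∙ sig (gapDirs dS I₃)
      ≡⟨ sig-fillGaps-split dP (region X b) dS g₀ I₁ W I₃ π≤n dirs≡ gapsFor |I₁|
           (trans (length-window X b P₀ A z Q₀ |P₀| |A| |Q₀|) (sym (length-region X b))) ⟨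
    sig (dirs (fillGaps (x ∷ u) (g₀ ∷ I₁ ++ W ++ I₃))) ∎
    where
    open ≡-Reasoning
    j = suc (length dP + windowBefore X)
    a = suc (suc b)
    W  = P₀ ++ A ++ z ∷ Q₀
    W′ = P₀ ++ rotateIn A z ++ Q₀
    P = g₀ ∷ I₁ ++ P₀
    unflat : g₀ ∷ I₁ ++ W ++ I₃ ≡ P ++ A ++ z ∷ Q₀ ++ I₃
    unflat = cong (g₀ ∷_) (reassoc I₁ P₀ A (z ∷ Q₀) I₃)
    unflat′ : g₀ ∷ I₁ ++ W′ ++ I₃ ≡ P ++ rotateIn A z ++ Q₀ ++ I₃
    unflat′ = cong (g₀ ∷_) (reassoc I₁ P₀ (rotateIn A z) Q₀ I₃)
    rotate≡ : rotateWindow j a (g₀ ∷ I₁ ++ W ++ I₃) ≡ g₀ ∷ I₁ ++ W′ ++ I₃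
    rotate≡ = trans (cong (rotateWindow j a) unflat)
                    (trans (rotateWindow-view P A z (Q₀ ++ I₃) (cong suc (trans (length-++ I₁) (cong₂ _+_ |I₁| |P₀|))) |A|)
                           (sym unflat′))
    gapsFor′ : GapsFor n (x′ ∷ u′) (g₀ ∷ I₁ ++ W′ ++ I₃)
    gapsFor′ = subst (GapsFor n (x′ ∷ u′)) (sym unflat′)
                 (GapsFor-resp {u = x ∷ u} {u′ = x′ ∷ u′} (concat-rotated P A z (Q₀ ++ I₃)) (length-rotated P A z (Q₀ ++ I₃)) |π′|
                   (subst (GapsFor n (x ∷ u)) unflat gapsFor))

[]≢++∷ : ∀ {Y : Set} (pre : List Y) {y ys} → [] ≢ pre ++ y ∷ ys
[]≢++∷ []      ()
[]≢++∷ (_ ∷ _) ()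

dirs-Ω : ∀ {n ℓ π π′} → Linked _≢_ π → Linked _≢_ π′ →
         3 ≤ ℓ → ℓ ≤ length (type π) → 3 ≤ nth (type π) ℓ → InΩ n ℓ π π′ →
         ∃ λ dP → ∃ λ dS → ∃ λ b → ∃ λ X → dirs π ≡ dP ++ region X b ++ dS × dirs π′ ≡ dP ++ region′ X b ++ dS
dirs-Ω {π = π} {π′} lπ lπ′ 3≤ℓ ℓ≤ 3≤tℓ (_ , χ≡ , type≡)
  with blocks-Ω (blocks (dirs π)) (blocks (dirs π′)) _ 3≤ℓ ℓ≤ 3≤tℓ type≡
... | pre , a , b , c , post , B≡ , B′≡ with π | π′ | lπ | lπ′
... | []        | _         | _         | _          = contradiction B≡ ([]≢++∷ pre)
... | _ ∷ []    | _         | _         | _          = contradiction B≡ ([]≢++∷ pre)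
... | _         | []        | _         | _          = contradiction B′≡ ([]≢++∷ pre)
... | _         | _ ∷ []    | _         | _          = contradiction B′≡ ([]≢++∷ pre)
... | p₁ ∷ p₂ ∷ w | q₁ ∷ q₂ ∷ w′ | p₁≢p₂ ∷ _ | q₁≢q₂ ∷ _
  with first≡ ← descentBit-injective (trans (sym (χ⁺≡descentBit w′ q₁≢q₂)) (trans χ≡ (χ⁺≡descentBit w p₁≢p₂)))
  with dirs-shape (p₁ <ᵇ p₂) (dirs (p₂ ∷ w)) (dirs (q₂ ∷ w′)) pre a b c post B≡
                  (subst (λ d → blocks (d ∷ dirs (q₂ ∷ w′)) ≡ pre ++ suc a ∷ b ∷ suc c ∷ post) first≡ B′≡)
... | dP , dS , b′ , X , dirs≡ , dirs′≡ = dP , dS , b′ , X , dirs≡ , trans (cong (_∷ dirs (q₂ ∷ w′)) first≡) dirs′≡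

range-≤ : ∀ n → All (_≤ n) (range n)
range-≤ n = All.map⁺ (All.applyUpTo⁺₁ id n id)

range-positive : ∀ n → All (0 <_) (range n)
range-positive n = All.map⁺ (All.applyUpTo⁺₁ id n (λ _ → z<s))

range-unique : ∀ n → Unique (range n)
range-unique n = Unique.map⁺ suc-injective (Unique.upTo⁺ n)

shiftRange-≰ : ∀ n m → All (_≰ n) (shiftRange n m)
shiftRange-≰ n m = All.map⁺ (All.applyUpTo⁺₁ id m (λ {i} _ → <⇒≱ (s≤s (m≤m+n n i))))

shiftRange-positive : ∀ n m → All (0 <_) (shiftRange n m)
shiftRange-positive n m = All.map⁺ (All.applyUpTo⁺₁ id m (λ _ → z<s))

shiftRange-unique : ∀ n m → Unique (shiftRange n m)
shiftRange-unique n m = Unique.map⁺ (λ eq → +-cancelˡ-≡ n _ _ (suc-injective eq)) (Unique.upTo⁺ m)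

record Letters (n : ℕ) (π σ : List ℕ) : Set where
  field
    small       : All (_≤ n) π
    big         : All (_≰ n) σ
    small-uniq  : Unique π
    uniq        : Unique (π ++ σ)
    positive    : All (0 <_) (π ++ σ)

letters : ∀ {n m π σ} → InL (range n) π → InL (shiftRange n m) σ → Letters n π σ
letters {n} {m} {π} {σ} π↭ σ↭ = record
  { small      = π≤n
  ; big        = σ≰n
  ; small-uniq = π-uniq
  ; uniq       = Unique.++⁺ π-uniq (Unique-resp-↭ (↭-sym σ↭) (shiftRange-unique n m))
                   (λ (v∈π , v∈σ) → All.lookup σ≰n v∈σ (All.lookup π≤n v∈π))
  ; positive   = All.++⁺ (All-resp-↭ (↭-sym π↭) (range-positive n)) (All-resp-↭ (↭-sym σ↭) (shiftRange-positive n m))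
  }
  where
  π≤n = All-resp-↭ (↭-sym π↭) (range-≤ n)
  σ≰n = All-resp-↭ (↭-sym σ↭) (shiftRange-≰ n m)
  π-uniq = Unique-resp-↭ (↭-sym π↭) (range-unique n)

window-fits : ∀ X b k r → suc (k + windowBefore X) + suc (suc (suc b)) ≤ suc (suc (k + ((4 + b) + r)))
window-fits X b k r = begin
  suc (k + windowBefore X) + (3 + b)     ≡⟨ cong suc (+-assoc k (windowBefore X) (3 + b)) ⟩
  suc (k + (windowBefore X + (3 + b)))   ≤⟨ s≤s (+-monoʳ-≤ k (window≤ X)) ⟩
  suc (k + (4 + b))                      ≤⟨ s≤s (+-monoʳ-≤ k (m≤m+n (4 + b) r)) ⟩
  suc (k + ((4 + b) + r))                ≤⟨ n≤1+n _ ⟩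
  suc (suc (k + ((4 + b) + r)))          ∎
  where
  open ≤-Reasoning
  window≤ : ∀ X → windowBefore X + (3 + b) ≤ 4 + b
  window≤ true  = n≤1+n _
  window≤ false = ≤-refl

rotation-bijection : ∀ {n x u x′ u′ σ} dP dS X b → Letters n (x ∷ u) σ → Letters n (x′ ∷ u′) σ →
                     dirs (x ∷ u) ≡ dP ++ region X b ++ dS → dirs (x′ ∷ u′) ≡ dP ++ region′ X b ++ dS →
                     StatPreservingBijection (x ∷ u) (x′ ∷ u′) σ
rotation-bijection {x = x} {u} dP dS X b L L′ dirs≡ dirs′≡ =
  statPreservingBijection (sig-rotateWindow dP dS X b (small L) (small L′) dirs≡ dirs′≡)
                          (uniq L) (uniq L′) (positive L) (positive L′) (λ ()) (λ ())
  where
  open Letters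
  fits : suc (length dP + windowBefore X) + suc (suc (suc b)) ≤ suc (length (x ∷ u))
  fits = subst (λ k → _ ≤ suc (suc k)) (sym (|u| dP dS X b (small L) (small L′) dirs≡ dirs′≡))
               (window-fits X b (length dP) (length dS))
  open WindowRotation (small L) (small L′) (big L) (|π′| dP dS X b (small L) (small L′) dirs≡ dirs′≡)
                      (suc (length dP + windowBefore X)) (suc (suc b)) fits

lemma4 : (m n : ℕ) → 1 ≤ m → 1 ≤ n →
         (π σ : List ℕ) → InL (range n) π → InL (shiftRange n m) σ →
         (ℓ : ℕ) → 3 ≤ ℓ → ℓ ≤ length (type π) → 3 ≤ nth (type π) ℓ →
         (π' : List ℕ) → InΩ n ℓ π π' →
         ∃ λ (φ : List ℕ → List ℕ) →
           (∀ τ → InS π σ τ →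
             InS π' σ (φ τ) × udr (φ τ) ≡ udr τ × pk (φ τ) ≡ pk τ × des (φ τ) ≡ des τ)
           × (∀ τ₁ τ₂ → InS π σ τ₁ → InS π σ τ₂ → φ τ₁ ≡ φ τ₂ → τ₁ ≡ τ₂)
           × (∀ ρ → InS π' σ ρ → ∃ λ τ → InS π σ τ × φ τ ≡ ρ)
lemma4 m n _ _ π σ π∈L σ∈L ℓ 3≤ℓ ℓ≤ 3≤tℓ π′ π′∈Ω
  with dirs-Ω (AllPairs⇒Linked (Letters.small-uniq (letters {m = m} π∈L σ∈L)))
              (AllPairs⇒Linked (Letters.small-uniq (letters {m = m} (proj₁ π′∈Ω) σ∈L))) 3≤ℓ ℓ≤ 3≤tℓ π′∈Ω
... | dP , dS , b , X , dirs≡ , dirs′≡ with π | π′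
...   | []    | _       = contradiction dirs≡ ([]≢++∷ dP)
...   | _     | []      = contradiction dirs′≡ ([]≢++∷ dP)
...   | _ ∷ _ | _ ∷ _   = rotation-bijection dP dS X b (letters π∈L σ∈L) (letters (proj₁ π′∈Ω) σ∈L) dirs≡ dirs′≡
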